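{- Let $r\ge 2$, $q=2^{r-1}$, and $m=p_1p_2\cdots p_r$ with $p_1,\dots,p_r$ distinct primes. Let $S=\{a\in\mathbb Z_m : a \bmod p_i\in\{0,1\}\text{ for all } i\in[r]\}\setminus\{0\}$ (so $|S\cup\{0\}|=2q$), identify each element of $\mathbb Z_m$ with its representative in $\{0,1,\dots,m-1\}$, and let $\mathcal R=\mathbb Z_m[\gamma]/(\gamma^m-1)$. Put $t_i=i-1$ for $i\in[q]$. Let $M$ be the $2q\times 2q$ matrix over $\mathcal R$ whose columns are indexed by $\ell\in\{0\}\cup S$ (with the column $\ell=0$ first), and whose rows come in pairs: for each $i\in[q]$, row $2i-1$ has entry $\gamma^{t_i\ell}$ in column $\ell$ and row $2i$ has entry $\ell\,\gamma^{t_i\ell}$ in column $\ell$. Then there exists a row vector $\boldsymbol\lambda=[\alpha_1,\beta_1,\dots,\alpha_q,\beta_q]\in\mathcal R^{2q}$ such that $\boldsymbol\lambda M=[\mu,0,\dots,0]$ (i.e. the entry in column $\ell=0$ is $\mu$ and all other entries are $0$) for some $\mu\in\mathcal R$ satisfying $\mu\bmod p_i\neq 0$ for every $i\in[r]$.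
   Context: Elements of $\mathcal R=\mathbb Z_m[\gamma]/(\gamma^m-1)$ are uniquely represented as $\sum_{j=0}^{m-1}c_j\gamma^j$ with $c_j\in\mathbb Z_m$; multiplication uses $\gamma^m=1$. For $\mu=\sum_j c_j\gamma^j\in\mathcal R$ and a prime $p$ dividing $m$, $\mu\bmod p$ denotes $\sum_j (c_j\bmod p)\gamma^j\in\mathbb Z_p[\gamma]/(\gamma^m-1)$, obtained by reducing each coefficient modulo $p$; $\mu\bmod p\neq 0$ means some coefficient is nonzero modulo $p$. -}

module Defs where

open import Data.Nat using (ℕ; zero; suc; _+_; _*_; _∸_; _<_; _≡ᵇ_; NonZero)
open import Data.Nat.DivMod using (_%_; m%n<n)
open import Data.Fin using (Fin; toℕ; fromℕ<) renaming (zero to fzero; suc to fsuc)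
open import Data.Bool using (if_then_else_)
open import Data.Product using (Σ; _×_)
open import Data.Sum using (_⊎_)
open import Relation.Binary.PropositionalEquality using (_≡_; _≢_)

Σfin : (n : ℕ) → (Fin n → ℕ) → ℕ
Σfin zero    f = 0
Σfin (suc n) f = f fzero + Σfin n (λ i → f (fsuc i))

Πfin : (n : ℕ) → (Fin n → ℕ) → ℕ
Πfin zero    f = 1
Πfin (suc n) f = f fzero * Πfin n (λ i → f (fsuc i))

-- Elements of R = ℤ_m[γ]/(γ^m - 1): coefficient vectors (c_0,…,c_{m-1}),
-- c_j ∈ ℕ read modulo m (equality is _≈R_ below).
R : ℕ → Set
R m = Fin m → ℕ

module _ (m : ℕ) .{{_ : NonZero m}} where

  idx : ℕ → Fin m
  idx j = fromℕ< (m%n<n j m)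

  mono : ℕ → ℕ → R m
  mono c e k = if toℕ k ≡ᵇ e % m then c else 0

  0R : R m
  0R _ = 0

  _+R_ : R m → R m → R m
  (f +R g) k = f k + g k

  -- cyclic convolution (uses γ^m = 1)
  _*R_ : R m → R m → R m
  (f *R g) k = Σfin m (λ i → f i * g (idx (toℕ k + m ∸ toℕ i)))

  _≈R_ : R m → R m → Set
  f ≈R g = ∀ k → f k % m ≡ g k % m

  sumR : (n : ℕ) → (Fin n → R m) → R m
  sumR n f k = Σfin n (λ i → f i k)

  -- Entry in column ℓ of the row vector λM, where
  -- λ = [α_1, β_1, …, α_q, β_q], row 2i-1 of M is γ^{t_i ℓ}, row 2i is ℓ γ^{t_i ℓ},
  -- and t_i = i - 1 (= toℕ of the 0-based index i : Fin q).
  colEntry : (q : ℕ) → (Fin q → R m) → (Fin q → R m) → ℕ → R m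
  colEntry q α β ℓ =
    sumR q (λ i → (α i *R mono 1 (toℕ i * ℓ)) +R (β i *R mono ℓ (toℕ i * ℓ)))

ModIn01 : ℕ → ℕ → Set
ModIn01 p a = Σ ℕ (λ k → (a ≡ k * p) ⊎ (a ≡ k * p + 1))

InS : (r : ℕ) → (Fin r → ℕ) → ℕ → ℕ → Set
InS r p m ℓ = (ℓ < m) × (ℓ ≢ 0) × (∀ i → ModIn01 (p i) ℓ)

module Submission where

-- Lemma 5.1.  Write r = s + 1, m = p 0 ⋯ p s = n + 1 and q = 2^s, and for each
-- prime index j let M j = m / p j.  Let P_j(x) = ∏ (x − γ^a) have as its q − 1
-- roots the γ^a with a ∈ S, p j ∣ a (one for each nonempty set of other primes).
-- Taking α_i = Σ_j M j·[x^i] P_j and β_i = −α_i, column ℓ of λM equals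
-- Σ_j M j·(1 − ℓ)·P_j(γ^ℓ).  For ℓ ∈ S every term vanishes: either ℓ ≡ 1 (mod p j)
-- and M j·(1 − ℓ) ≡ 0 (mod m), or p j ∣ ℓ and γ^ℓ is a root of P_j.  Column 0 is
-- μ = Σ_j M j·P_j(1) and M i·μ = M i²·P_i(1), so p i ∣ μ would give p i ∣ P_i(1).
-- But every root x of P_i satisfies x^(M i) = 1, whence (1 − x)·W_x·v = −M i·v for
-- v = ∏_{k ≠ i} (1 − γ^(M k)); so P_i(1)·W·v = (−M i)^(q−1)·v, whereas v has
-- constant coefficient 1 and p i divides neither −1 ≡ n nor M i.

open import Defs
open import Data.Nat using (ℕ; suc; NonZero)
open import Data.Fin using (Fin)
open import Data.Nat.Primality using (Prime)
open import Relation.Binary.PropositionalEquality using (_≡_)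
open import Algebra.Bundles using (CommutativeRing)

module FinSum where

  open import Data.Nat using (zero; suc; _+_; _*_; _≡ᵇ_)
  open import Data.Nat.Properties using (+-*-semiring; *-comm; +-identityʳ)
  open import Data.Nat.Divisibility using (_∣_; _∣0; ∣m∣n⇒∣m+n)
  open import Data.Fin using (toℕ) renaming (zero to fzero; suc to fsuc)
  open import Data.Fin.Permutation using (permutation)
  open import Data.Bool using (if_then_else_)
  open import Function using (_∘_)
  open import Relation.Binary.PropositionalEquality
  open import Algebra.Properties.Semiring.Sum +-*-semiring using (sum; sum-cong-≗; ∑-distrib-+; ∑-comm; sum-permute; *-distribˡ-sum)
  open ≡-Reasoning

  Σfin≡sum : ∀ n (F : Fin n → ℕ) → Σfin n F ≡ sum F
  Σfin≡sum zero    F = refl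
  Σfin≡sum (suc n) F = cong (F fzero +_) (Σfin≡sum n (F ∘ fsuc))

  Σ-cong : ∀ n {F G : Fin n → ℕ} → (∀ i → F i ≡ G i) → Σfin n F ≡ Σfin n G
  Σ-cong n {F} {G} F≗G = begin
    Σfin n F ≡⟨ Σfin≡sum n F ⟩
    sum F    ≡⟨ sum-cong-≗ F≗G ⟩
    sum G    ≡⟨ Σfin≡sum n G ⟨
    Σfin n G ∎

  Σ-+ : ∀ n (F G : Fin n → ℕ) → Σfin n (λ i → F i + G i) ≡ Σfin n F + Σfin n G
  Σ-+ n F G = begin
    Σfin n (λ i → F i + G i) ≡⟨ Σfin≡sum n _ ⟩
    sum (λ i → F i + G i)    ≡⟨ ∑-distrib-+ F G ⟩
    sum F + sum G            ≡⟨ cong₂ _+_ (Σfin≡sum n F) (Σfin≡sum n G) ⟨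
    Σfin n F + Σfin n G      ∎

  Σ-*ˡ : ∀ n c (F : Fin n → ℕ) → Σfin n (λ i → c * F i) ≡ c * Σfin n F
  Σ-*ˡ n c F = begin
    Σfin n (λ i → c * F i) ≡⟨ Σfin≡sum n _ ⟩
    sum (λ i → c * F i)    ≡⟨ *-distribˡ-sum c F ⟨
    c * sum F              ≡⟨ cong (c *_) (Σfin≡sum n F) ⟨
    c * Σfin n F           ∎

  Σ-*ʳ : ∀ n c (F : Fin n → ℕ) → Σfin n (λ i → F i * c) ≡ Σfin n F * c
  Σ-*ʳ n c F = begin
    Σfin n (λ i → F i * c) ≡⟨ Σ-cong n (λ i → *-comm (F i) c) ⟩
    Σfin n (λ i → c * F i) ≡⟨ Σ-*ˡ n c F ⟩
    c * Σfin n F           ≡⟨ *-comm c _ ⟩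
    Σfin n F * c           ∎

  Σ-swap : ∀ a b (F : Fin a → Fin b → ℕ) →
    Σfin a (λ i → Σfin b (F i)) ≡ Σfin b (λ j → Σfin a (λ i → F i j))
  Σ-swap a b F = begin
    Σfin a (λ i → Σfin b (F i))           ≡⟨ Σ-cong a (λ i → Σfin≡sum b (F i)) ⟩
    Σfin a (λ i → sum (F i))              ≡⟨ Σfin≡sum a _ ⟩
    sum (λ i → sum (F i))                 ≡⟨ ∑-comm F ⟩
    sum (λ j → sum (λ i → F i j))         ≡⟨ Σfin≡sum b _ ⟨
    Σfin b (λ j → sum (λ i → F i j))      ≡⟨ Σ-cong b (λ j → Σfin≡sum a (λ i → F i j)) ⟨
    Σfin b (λ j → Σfin a (λ i → F i j))   ∎

  Σ-reindex : ∀ n (F : Fin n → ℕ) (σ τ : Fin n → Fin n) →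
    (∀ i → σ (τ i) ≡ i) → (∀ i → τ (σ i) ≡ i) → Σfin n F ≡ Σfin n (F ∘ σ)
  Σ-reindex n F σ τ στ τσ = begin
    Σfin n F       ≡⟨ Σfin≡sum n F ⟩
    sum F          ≡⟨ sum-permute F (permutation σ τ στ τσ) ⟩
    sum (F ∘ σ)    ≡⟨ Σfin≡sum n (F ∘ σ) ⟨
    Σfin n (F ∘ σ) ∎

  Σ-zero : ∀ n → Σfin n (λ _ → 0) ≡ 0
  Σ-zero zero    = refl
  Σ-zero (suc n) = Σ-zero n

  Σ-delta : ∀ n (X : Fin n → ℕ) (t : Fin n) {c} → toℕ t ≡ c →
    Σfin n (λ i → if toℕ i ≡ᵇ c then X i else 0) ≡ X t
  Σ-delta (suc n) X fzero    refl = trans (cong (X fzero +_) (Σ-zero n)) (+-identityʳ _)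
  Σ-delta (suc n) X (fsuc t) refl = Σ-delta n (X ∘ fsuc) t refl

  Σ-∣ : ∀ {d} n (F : Fin n → ℕ) → (∀ i → d ∣ F i) → d ∣ Σfin n F
  Σ-∣ {d} zero    F d∣F = d ∣0
  Σ-∣     (suc n) F d∣F = ∣m∣n⇒∣m+n (d∣F fzero) (Σ-∣ n (F ∘ fsuc) (d∣F ∘ fsuc))

module Congruence (d : ℕ) .{{_ : NonZero d}} where

  open import Data.Nat using (zero; suc; _+_; _*_; _∸_; _<_)
  open import Data.Fin using (Fin) renaming (zero to fzero; suc to fsuc)
  open import Function using (_∘_)
  open import Data.Nat.Properties using (+-identityʳ; +-assoc; m+[n∸m]≡n; <⇒≤)
  open import Data.Nat.DivMod using (_%_; %-distribˡ-+; %-distribˡ-*; m%n%n≡m%n; m%n<n; m<n⇒m%n≡m)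
  open import Data.Nat.Divisibility using (_∣_; divides; n∣m⇒m%n≡0; m%n≡0⇒n∣m; %-presˡ-∣; ∣n∣m%n⇒∣m)
  open import Relation.Binary.PropositionalEquality
  open import Relation.Binary.Structures using (IsEquivalence)
  open import Relation.Binary.Bundles using (Setoid)

  -- a ≋ b : a and b are congruent modulo d.  A record rather than a bare
  -- equation of remainders, so that a and b can be recovered by unification.
  infix 4 _≋_
  record _≋_ (a b : ℕ) : Set where
    constructor mk≋
    field un≋ : a % d ≡ b % d
  open _≋_ public

  ≋-isEquivalence : IsEquivalence _≋_
  ≋-isEquivalence = record
    { refl  = mk≋ refl
    ; sym   = λ (mk≋ e) → mk≋ (sym e)
    ; trans = λ (mk≋ e) (mk≋ f) → mk≋ (trans e f)
    }

  ≋-setoid : Setoid _ _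
  ≋-setoid = record { isEquivalence = ≋-isEquivalence }

  open IsEquivalence ≋-isEquivalence public
    renaming (refl to ≋-refl; sym to ≋-sym; trans to ≋-trans; reflexive to ≡⇒≋)

  ≋-+ : ∀ {a a′ b b′} → a ≋ a′ → b ≋ b′ → a + b ≋ a′ + b′
  ≋-+ {a} {a′} {b} {b′} (mk≋ e) (mk≋ f) = mk≋ (begin
    (a + b) % d                ≡⟨ %-distribˡ-+ a b d ⟩
    (a % d + b % d) % d        ≡⟨ cong₂ (λ x y → (x + y) % d) e f ⟩
    (a′ % d + b′ % d) % d      ≡⟨ %-distribˡ-+ a′ b′ d ⟨
    (a′ + b′) % d              ∎)
    where open ≡-Reasoning

  ≋-* : ∀ {a a′ b b′} → a ≋ a′ → b ≋ b′ → a * b ≋ a′ * b′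
  ≋-* {a} {a′} {b} {b′} (mk≋ e) (mk≋ f) = mk≋ (begin
    (a * b) % d                ≡⟨ %-distribˡ-* a b d ⟩
    (a % d * (b % d)) % d      ≡⟨ cong₂ (λ x y → (x * y) % d) e f ⟩
    (a′ % d * (b′ % d)) % d    ≡⟨ %-distribˡ-* a′ b′ d ⟨
    (a′ * b′) % d              ∎)
    where open ≡-Reasoning

  %-≋ : ∀ a → a % d ≋ a
  %-≋ a = mk≋ (m%n%n≡m%n a d)

  0%d≡0 : 0 % d ≡ 0
  0%d≡0 = n∣m⇒m%n≡0 0 d (divides 0 refl)

  ∣⇒≋0 : ∀ {a} → d ∣ a → a ≋ 0
  ∣⇒≋0 {a} d∣a = mk≋ (trans (n∣m⇒m%n≡0 a d d∣a) (sym 0%d≡0))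

  ≋0⇒∣ : ∀ {a} → a ≋ 0 → d ∣ a
  ≋0⇒∣ {a} (mk≋ e) = m%n≡0⇒n∣m a d (trans e 0%d≡0)

  -- addition modulo d is cancellative: add the complement t of c
  ≋-cancelʳ : ∀ {a b} c → a + c ≋ b + c → a ≋ b
  ≋-cancelʳ {a} {b} c a+c≋b+c = begin
    a           ≡⟨ +-identityʳ a ⟨
    a + 0       ≈⟨ ≋-+ (≋-refl {a}) (≋-sym c+t≋0) ⟩
    a + (c + t) ≡⟨ +-assoc a c t ⟨
    a + c + t   ≈⟨ ≋-+ a+c≋b+c (≋-refl {t}) ⟩
    b + c + t   ≡⟨ +-assoc b c t ⟩
    b + (c + t) ≈⟨ ≋-+ (≋-refl {b}) c+t≋0 ⟩
    b + 0       ≡⟨ +-identityʳ b ⟩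
    b           ∎
    where
    open import Relation.Binary.Reasoning.Setoid ≋-setoid
    t : ℕ
    t = d ∸ c % d
    c+t≋0 : c + t ≋ 0
    c+t≋0 = ≋-trans (≋-+ (≋-sym (%-≋ c)) (≋-refl {t}))
              (≋-trans (≡⇒≋ (m+[n∸m]≡n (<⇒≤ (m%n<n c d))))
                       (∣⇒≋0 (divides 1 (sym (+-identityʳ d)))))

  ≋⇒≡ : ∀ {a b} → a < d → b < d → a ≋ b → a ≡ b
  ≋⇒≡ {a} {b} a<d b<d (mk≋ e) = trans (sym (m<n⇒m%n≡m a<d)) (trans e (m<n⇒m%n≡m b<d))

  ≋-∣ : ∀ {e a b} → e ∣ d → a ≋ b → e ∣ a → e ∣ b
  ≋-∣ e∣d (mk≋ a≡b) e∣a = ∣n∣m%n⇒∣m e∣d (subst (_ ∣_) a≡b (%-presˡ-∣ e∣a e∣d))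

  Σ-≋ : ∀ n (F G : Fin n → ℕ) → (∀ i → F i ≋ G i) → Σfin n F ≋ Σfin n G
  Σ-≋ zero    F G F≋G = ≋-refl
  Σ-≋ (suc n) F G F≋G = ≋-+ (F≋G fzero) (Σ-≋ n (F ∘ fsuc) (G ∘ fsuc) (F≋G ∘ fsuc))

module PrimeProducts where

  open import Data.Nat using (zero; suc; _*_; _+_; _∸_; nonTrivial⇒≢1)
  open import Data.Nat.Properties using (*-assoc; *-comm; <⇒≤; m+[n∸m]≡n)
  open import Data.Nat.DivMod using (_%_; m%n<n; m∣n⇒o%n%m≡o%m)
  open import Data.Nat.Divisibility using (_∣_; divides; ∣1⇒≡1; m∣m*n; 1∣_; *-monoˡ-∣; ∣-refl)
  open import Data.Nat.Primality using (euclidsLemma; prime⇒irreducible; prime⇒nonTrivial; prime⇒nonZero)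
  open import Data.Nat.Coprimality using (Coprime; coprime-divisor)
  open import Data.Fin using (Fin; punchIn; punchOut) renaming (zero to fzero; suc to fsuc)
  open import Data.Fin.Properties using (punchInᵢ≢i; punchIn-punchOut; suc-injective)
  open import Data.Product using (Σ; _,_)
  open import Data.Sum using (inj₁; inj₂)
  open import Data.Empty using (⊥-elim)
  open import Relation.Nullary using (¬_)
  open import Relation.Binary.PropositionalEquality
  open import Function using (_∘_)

  prime∤1 : ∀ {P} → Prime P → ¬ (P ∣ 1)
  prime∤1 pP P∣1 = nonTrivial⇒≢1 {{prime⇒nonTrivial pP}} (∣1⇒≡1 P∣1)

  Π-punch : ∀ r (p : Fin (suc r) → ℕ) i → Πfin (suc r) p ≡ p i * Πfin r (p ∘ punchIn i)
  Π-punch r       p fzero    = refl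
  Π-punch (suc r) p (fsuc i) = begin
    p fzero * Πfin (suc r) (p ∘ fsuc)  ≡⟨ cong (p fzero *_) (Π-punch r (p ∘ fsuc) i) ⟩
    p fzero * (p (fsuc i) * X)         ≡⟨ *-assoc (p fzero) _ X ⟨
    p fzero * p (fsuc i) * X           ≡⟨ cong (_* X) (*-comm (p fzero) _) ⟩
    p (fsuc i) * p fzero * X           ≡⟨ *-assoc (p (fsuc i)) _ X ⟩
    p (fsuc i) * (p fzero * X)         ∎
    where
    open ≡-Reasoning
    X : ℕ
    X = Πfin r (p ∘ fsuc ∘ punchIn i)

  factor∣Π : ∀ r (p : Fin r → ℕ) i → p i ∣ Πfin r p
  factor∣Π (suc r) p i = subst (p i ∣_) (sym (Π-punch r p i)) (m∣m*n _)

  prime∣Π : ∀ {P} r (p : Fin r → ℕ) → Prime P → P ∣ Πfin r p → Σ (Fin r) (λ i → P ∣ p i)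
  prime∣Π zero    p pP P∣1 = ⊥-elim (prime∤1 pP P∣1)
  prime∣Π (suc r) p pP P∣Π with euclidsLemma (p fzero) (Πfin r (p ∘ fsuc)) pP P∣Π
  ... | inj₁ P∣p₀ = fzero , P∣p₀
  ... | inj₂ P∣Π′ with prime∣Π r (p ∘ fsuc) pP P∣Π′
  ...   | i , P∣pᵢ = fsuc i , P∣pᵢ

  prime∣prime : ∀ {P Q} → Prime P → Prime Q → P ∣ Q → P ≡ Q
  prime∣prime pP pQ P∣Q with prime⇒irreducible pQ P∣Q
  ... | inj₁ P≡1 = ⊥-elim (nonTrivial⇒≢1 {{prime⇒nonTrivial pP}} P≡1)
  ... | inj₂ P≡Q = P≡Q

  ∤Π-others : ∀ {r s} (p : Fin r → ℕ) → (∀ i → Prime (p i)) → (∀ i j → p i ≡ p j → i ≡ j) →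
    (f : Fin s → Fin r) → ∀ i → (∀ k → f k ≢ i) → ¬ (p i ∣ Πfin s (p ∘ f))
  ∤Π-others p prime distinct f i avoid pᵢ∣Π with prime∣Π _ (p ∘ f) (prime i) pᵢ∣Π
  ... | k , pᵢ∣p[fk] = avoid k (sym (distinct i (f k) (prime∣prime (prime i) (prime (f k)) pᵢ∣p[fk])))

  Π∣ : ∀ r (p : Fin r → ℕ) → (∀ i → Prime (p i)) → (∀ i j → p i ≡ p j → i ≡ j) →
    ∀ X → (∀ i → p i ∣ X) → Πfin r p ∣ X
  Π∣ zero    p prime distinct X pᵢ∣X = 1∣ X
  Π∣ (suc r) p prime distinct X pᵢ∣X
    with Π∣ r (p ∘ fsuc) (prime ∘ fsuc) (λ i j e → suc-injective (distinct (fsuc i) (fsuc j) e)) X (pᵢ∣X ∘ fsuc)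
  ... | divides t X≡t*Π′ = subst (p fzero * Π′ ∣_) (sym X≡t*Π′) (*-monoˡ-∣ Π′ p₀∣t)
    where
    Π′ : ℕ
    Π′ = Πfin r (p ∘ fsuc)
    coprime : Coprime (p fzero) Π′
    coprime {d} (d∣p₀ , d∣Π′) with prime⇒irreducible (prime fzero) d∣p₀
    ... | inj₁ d≡1 = d≡1
    ... | inj₂ refl = ⊥-elim (∤Π-others p prime distinct fsuc fzero (λ k ()) d∣Π′)
    p₀∣t : p fzero ∣ t
    p₀∣t = coprime-divisor coprime (subst (p fzero ∣_) (*-comm t Π′) (subst (p fzero ∣_) X≡t*Π′ (pᵢ∣X fzero)))

  module SquarefreeModulus (r : ℕ) (p : Fin r → ℕ) (prime : ∀ i → Prime (p i))
    (distinct : ∀ i j → p i ≡ p j → i ≡ j) (m : ℕ) .{{_ : NonZero m}} (m≡Π : m ≡ Πfin r p) where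

    instance
      pᵢ-nonZero : ∀ {i} → NonZero (p i)
      pᵢ-nonZero {i} = prime⇒nonZero (prime i)

    pᵢ∣m : ∀ i → p i ∣ m
    pᵢ∣m i = subst (p i ∣_) (sym m≡Π) (factor∣Π r p i)

    all-pᵢ∣⇒m∣ : ∀ X → (∀ i → p i ∣ X) → m ∣ X
    all-pᵢ∣⇒m∣ X pᵢ∣X = subst (_∣ X) (sym m≡Π) (Π∣ r p prime distinct X pᵢ∣X)

    -- if a ≡ b modulo every p i, then p i ∣ a + (m − b % m) for all i, hence m divides it
    crt : ∀ a b → (∀ i → a % p i ≡ b % p i) → a % m ≡ b % m
    crt a b a≡b = un≋ (≋-trans (≋-cancelʳ t (≋-trans a+t≋0 (≋-sym e+t≋0))) (%-≋ b))
      where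
      open Congruence m
      e : ℕ
      e = b % m
      t : ℕ
      t = m ∸ e
      e+t≡m : e + t ≡ m
      e+t≡m = m+[n∸m]≡n (<⇒≤ (m%n<n b m))
      e+t≋0 : e + t ≋ 0
      e+t≋0 = ∣⇒≋0 (subst (m ∣_) (sym e+t≡m) ∣-refl)
      pᵢ∣a+t : ∀ i → p i ∣ a + t
      pᵢ∣a+t i = Pᵢ.≋0⇒∣ (begin
        a + t ≈⟨ Pᵢ.≋-+ (Pᵢ.mk≋ (trans (a≡b i) (sym (m∣n⇒o%n%m≡o%m (p i) m b (pᵢ∣m i))))) Pᵢ.≋-refl ⟩
        e + t ≡⟨ e+t≡m ⟩
        m     ≈⟨ Pᵢ.∣⇒≋0 (pᵢ∣m i) ⟩
        0     ∎)
        where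
        module Pᵢ = Congruence (p i)
        open import Relation.Binary.Reasoning.Setoid Pᵢ.≋-setoid
      a+t≋0 : a + t ≋ 0
      a+t≋0 = ∣⇒≋0 (all-pᵢ∣⇒m∣ (a + t) pᵢ∣a+t)

  module Cofactors (s : ℕ) (p : Fin (suc s) → ℕ) (prime : ∀ i → Prime (p i))
    (distinct : ∀ i j → p i ≡ p j → i ≡ j) where

    M : Fin (suc s) → ℕ
    M i = Πfin s (p ∘ punchIn i)

    Π≡p*M : ∀ i → Πfin (suc s) p ≡ p i * M i
    Π≡p*M = Π-punch s p

    pᵢ∤Mᵢ : ∀ i → ¬ (p i ∣ M i)
    pᵢ∤Mᵢ i = ∤Π-others p prime distinct (punchIn i) i (punchInᵢ≢i i)

    pₖ∣Mᵢ : ∀ {k i} → k ≢ i → p k ∣ M i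
    pₖ∣Mᵢ {k} {i} k≢i = subst (λ z → p z ∣ M i) (punchIn-punchOut i≢k) (factor∣Π s (p ∘ punchIn i) (punchOut i≢k))
      where
      i≢k : i ≢ k
      i≢k = k≢i ∘ sym

module CommutativeRingFacts {c ℓ} (CR : CommutativeRing c ℓ) where

  open import Data.Nat using (ℕ; zero; suc; _≤_; z≤n; s≤s)
  open import Data.Nat.Properties using (≤-trans)
  open import Data.Fin using (Fin; toℕ; punchIn) renaming (zero to fzero; suc to fsuc)
  open import Data.Fin.Properties using (punchInᵢ≢i)
  open import Data.List using (List; []; _∷_; length)
  open import Data.List.Membership.Propositional using (_∈_)
  open import Data.List.Relation.Unary.Any using (here; there)
  open import Data.List.Relation.Unary.All using (All; []; _∷_)
  open import Data.Product using (Σ; _,_)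
  open import Data.Maybe using (nothing)
  open import Function using (_∘_)
  open import Relation.Binary.PropositionalEquality using (_≢_) renaming (refl to ≡-refl)

  open CommutativeRing CR
  open import Relation.Binary.Reasoning.Setoid setoid
  open import Algebra.Properties.Ring ring using (-‿distribˡ-*; -‿distribʳ-*)
  open import Algebra.Properties.Group +-group using (∙-cancelʳ; inverseˡ-unique)
  open import Algebra.Properties.Semiring.Sum semiring
    using (sum; sum-syntax; sum-cong-≋; sum-replicate-zero; sum-remove; ∑-distrib-+; ∑-comm; *-distribˡ-sum; *-distribʳ-sum)
  open import Algebra.Properties.Semiring.Exp semiring using (_^_)
  open import Algebra.Properties.Semiring.Mult semiring using (_×_; ×-congʳ; ×-comm-*)
  open import Algebra.Properties.CommutativeMonoid.Sum *-commutativeMonoid using () renaming (sum to product)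
  open import Algebra.Solver.Ring.NaturalCoefficients commutativeSemiring (λ _ _ → nothing)

  +-cancelʳ : ∀ {a b} z → a + z ≈ b + z → a ≈ b
  +-cancelʳ {a} {b} z = ∙-cancelʳ z a b

  sum-zero : ∀ {q} (f : Fin q → Carrier) → (∀ i → f i ≈ 0#) → sum f ≈ 0#
  sum-zero {q} f f≈0 = trans (sum-cong-≋ f≈0) (sum-replicate-zero q)

  sum-single : ∀ {q} (f : Fin (suc q) → Carrier) i → (∀ j → j ≢ i → f j ≈ 0#) → sum f ≈ f i
  sum-single f i others = begin
    sum f                                   ≈⟨ sum-remove {i = i} f ⟩
    f i + sum (λ j → f (punchIn i j))        ≈⟨ +-congˡ (sum-zero _ (λ j → others (punchIn i j) (punchInᵢ≢i i j))) ⟩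
    f i + 0#                                ≈⟨ +-identityʳ _ ⟩
    f i                                     ∎

  -- Polynomials, as coefficient lists with the constant term first.

  eval : List Carrier → Carrier → Carrier
  eval []      x = 0#
  eval (a ∷ P) x = a + x * eval P x

  coeff : List Carrier → ℕ → Carrier
  coeff []      i       = 0#
  coeff (a ∷ P) zero    = a
  coeff (a ∷ P) (suc i) = coeff P i

  sum-coeff : ∀ q P x → length P ≤ q → ∑[ i < q ] (coeff P (toℕ i) * x ^ toℕ i) ≈ eval P x
  sum-coeff zero    []      x z≤n     = refl
  sum-coeff (suc q) []      x _       = sum-zero {suc q} (λ i → 0# * x ^ toℕ i) (λ i → zeroˡ _)
  sum-coeff (suc q) (a ∷ P) x (s≤s h) = +-cong (*-identityʳ a) (begin
    ∑[ i < q ] (coeff P (toℕ i) * (x * x ^ toℕ i)) ≈⟨ sum-cong-≋ {q} (λ i → x*[y*z]≈y*[x*z] (coeff P (toℕ i)) x (x ^ toℕ i)) ⟩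
    ∑[ i < q ] (x * (coeff P (toℕ i) * x ^ toℕ i)) ≈⟨ *-distribˡ-sum {q} x (λ i → coeff P (toℕ i) * x ^ toℕ i) ⟨
    x * ∑[ i < q ] (coeff P (toℕ i) * x ^ toℕ i)   ≈⟨ *-congˡ (sum-coeff q P x h) ⟩
    x * eval P x                                  ∎)
    where
    x*[y*z]≈y*[x*z] : ∀ a b c → a * (b * c) ≈ b * (a * c)
    x*[y*z]≈y*[x*z] = solve 3 (λ a b c → a :* (b :* c) := b :* (a :* c)) refl

  ∏roots : List Carrier → Carrier → Carrier
  ∏roots []       x = 1#
  ∏roots (c ∷ cs) x = (x - c) * ∏roots cs x

  -- coefficients of (x − c)·P, computed from those of P
  addConst : Carrier → List Carrier → List Carrier
  addConst a []      = a ∷ []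
  addConst a (b ∷ Q) = (a + b) ∷ Q

  mulRoot : Carrier → List Carrier → List Carrier
  mulRoot c []      = []
  mulRoot c (a ∷ P) = - (c * a) ∷ addConst a (mulRoot c P)

  rootPoly : List Carrier → List Carrier
  rootPoly []       = 1# ∷ []
  rootPoly (c ∷ cs) = mulRoot c (rootPoly cs)

  eval-addConst : ∀ a Q x → eval (addConst a Q) x ≈ a + eval Q x
  eval-addConst a []      x = +-congˡ (zeroʳ x)
  eval-addConst a (b ∷ Q) x = +-assoc a b _

  eval-mulRoot : ∀ c P x → eval (mulRoot c P) x ≈ (x - c) * eval P x
  eval-mulRoot c []      x = sym (zeroʳ _)
  eval-mulRoot c (a ∷ P) x = begin
    - (c * a) + x * eval (addConst a (mulRoot c P)) x
      ≈⟨ +-cong (-‿distribˡ-* c a) (*-congˡ (trans (eval-addConst a (mulRoot c P) x) (+-congˡ (eval-mulRoot c P x)))) ⟩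
    (- c) * a + x * (a + (x - c) * eval P x)
      ≈⟨ solve 4 (λ nc a x E → nc :* a :+ x :* (a :+ (x :+ nc) :* E) := (x :+ nc) :* (a :+ x :* E)) refl (- c) a x (eval P x) ⟩
    (x - c) * (a + x * eval P x) ∎

  eval-rootPoly : ∀ cs x → eval (rootPoly cs) x ≈ ∏roots cs x
  eval-rootPoly []       x = trans (+-congˡ (zeroʳ x)) (+-identityʳ 1#)
  eval-rootPoly (c ∷ cs) x = trans (eval-mulRoot c (rootPoly cs) x) (*-congˡ (eval-rootPoly cs x))

  length-rootPoly : ∀ cs → length (rootPoly cs) ≤ suc (length cs)
  length-rootPoly []       = s≤s z≤n
  length-rootPoly (c ∷ cs) = ≤-trans (length-mulRoot c (rootPoly cs)) (s≤s (length-rootPoly cs))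
    where
    length-addConst : ∀ a Q {k} → 1 ≤ k → length Q ≤ k → length (addConst a Q) ≤ k
    length-addConst a []      1≤k _ = 1≤k
    length-addConst a (b ∷ Q) _   h = h
    length-mulRoot : ∀ c P → length (mulRoot c P) ≤ suc (length P)
    length-mulRoot c []      = z≤n
    length-mulRoot c (a ∷ P) = s≤s (length-addConst a (mulRoot c P) (s≤s z≤n) (length-mulRoot c P))

  ∏roots-root : ∀ cs x {c} → c ∈ cs → x ≈ c → ∏roots cs x ≈ 0#
  ∏roots-root (c ∷ cs) x (here ≡-refl) x≈c = trans (*-congʳ (trans (+-congʳ x≈c) (-‿inverseʳ c))) (zeroˡ _)
  ∏roots-root (c ∷ cs) x (there c∈cs) x≈c = trans (*-congˡ (∏roots-root cs x c∈cs x≈c)) (zeroʳ _)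

  geo : Carrier → ℕ → Carrier
  geo x zero    = 0#
  geo x (suc N) = 1# + x * geo x N

  -- Σ_{t<N} t·x^t
  wsum : Carrier → ℕ → Carrier
  wsum x zero    = 0#
  wsum x (suc N) = x * (wsum x N + geo x N)

  geo-telescope : ∀ x N → (1# - x) * geo x N + x ^ N ≈ 1#
  geo-telescope x zero    = trans (+-congʳ (zeroʳ _)) (+-identityˡ 1#)
  geo-telescope x (suc N) = begin
    (1# - x) * (1# + x * G) + x * x ^ N
      ≈⟨ solve 4 (λ nx x G p → (con 1 :+ nx) :* (con 1 :+ x :* G) :+ x :* p
                              := (con 1 :+ nx) :+ x :* ((con 1 :+ nx) :* G :+ p)) refl (- x) x G (x ^ N) ⟩
    (1# - x) + x * ((1# - x) * G + x ^ N) ≈⟨ +-congˡ (*-congˡ (geo-telescope x N)) ⟩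
    (1# - x) + x * 1#                     ≈⟨ solve 2 (λ nx x → (con 1 :+ nx) :+ x :* (con 1) := (con 1) :+ (x :+ nx)) refl (- x) x ⟩
    1# + (x - x)                          ≈⟨ trans (+-congˡ (-‿inverseʳ x)) (+-identityʳ 1#) ⟩
    1#                                    ∎
    where
    G : Carrier
    G = geo x N

  wsum-telescope : ∀ x N → (1# - x) * wsum x N + N × x ^ N + 1# ≈ geo x N + x ^ N
  wsum-telescope x zero    = +-congʳ (trans (+-congʳ (zeroʳ _)) (+-identityˡ 0#))
  wsum-telescope x (suc N) = begin
    (1# - x) * (x * (W + G)) + (x * p + N × (x * p)) + 1#
      ≈⟨ +-congʳ (+-congˡ (+-congˡ (sym (×-comm-* N x p)))) ⟩
    (1# - x) * (x * (W + G)) + (x * p + x * (N × p)) + 1#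
      ≈⟨ solve 6 (λ nx x W G p K → (con 1 :+ nx) :* (x :* (W :+ G)) :+ (x :* p :+ x :* K) :+ con 1
                                  := x :* ((con 1 :+ nx) :* W :+ K) :+ x :* ((con 1 :+ nx) :* G :+ p) :+ con 1)
                 refl (- x) x W G p (N × p) ⟩
    x * ((1# - x) * W + N × p) + x * ((1# - x) * G + p) + 1#
      ≈⟨ +-congʳ (+-congˡ (*-congˡ (geo-telescope x N))) ⟩
    x * ((1# - x) * W + N × p) + x * 1# + 1#
      ≈⟨ solve 2 (λ x A → x :* A :+ x :* con 1 :+ con 1 := x :* (A :+ con 1) :+ con 1) refl x _ ⟩
    x * ((1# - x) * W + N × p + 1#) + 1#
      ≈⟨ +-congʳ (*-congˡ (wsum-telescope x N)) ⟩
    x * (G + p) + 1#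
      ≈⟨ solve 3 (λ x G p → x :* (G :+ p) :+ con 1 := (con 1 :+ x :* G) :+ x :* p) refl x G p ⟩
    (1# + x * G) + x * p ∎
    where
    W : Carrier
    W = wsum x N
    G : Carrier
    G = geo x N
    p : Carrier
    p = x ^ N

  -- if x ^ N ≈ 1 then (1 − x) G ≈ 0, i.e. G·x ≈ G, hence G·x^a ≈ G for all a
  geo-absorbs : ∀ x N → x ^ N ≈ 1# → ∀ a → geo x N * x ^ a ≈ geo x N
  geo-absorbs x N xᴺ≈1 zero    = *-identityʳ _
  geo-absorbs x N xᴺ≈1 (suc a) = begin
    G * (x * x ^ a)  ≈⟨ solve 3 (λ G x p → G :* (x :* p) := G :* x :* p) refl G x (x ^ a) ⟩
    G * x * x ^ a    ≈⟨ *-congʳ Gx≈G ⟩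
    G * x ^ a        ≈⟨ geo-absorbs x N xᴺ≈1 a ⟩
    G                ∎
    where
    G : Carrier
    G = geo x N
    [1-x]G≈0 : (1# - x) * G ≈ 0#
    [1-x]G≈0 = +-cancelʳ 1# (trans (trans (+-congˡ (sym xᴺ≈1)) (geo-telescope x N)) (sym (+-identityˡ 1#)))
    Gx≈G : G * x ≈ G
    Gx≈G = begin
      G * x                    ≈⟨ sym (+-identityʳ _) ⟩
      G * x + 0#               ≈⟨ +-congˡ (sym [1-x]G≈0) ⟩
      G * x + (1# - x) * G     ≈⟨ solve 3 (λ G x nx → G :* x :+ (con 1 :+ nx) :* G := G :+ (x :+ nx) :* G) refl G x (- x) ⟩
      G + (x - x) * G          ≈⟨ +-congˡ (trans (*-congʳ (-‿inverseʳ x)) (zeroˡ G)) ⟩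
      G + 0#                   ≈⟨ +-identityʳ G ⟩
      G                        ∎

  geo-annihilates : ∀ x N a {g} → x ^ N ≈ 1# → x ^ a ≈ g → geo x N * (1# - g) ≈ 0#
  geo-annihilates x N a {g} xᴺ≈1 xᵃ≈g = begin
    G * (1# - g)       ≈⟨ distribˡ G 1# (- g) ⟩
    G * 1# + G * (- g) ≈⟨ +-cong (*-identityʳ G) (sym (-‿distribʳ-* G g)) ⟩
    G - G * g          ≈⟨ +-congˡ (-‿cong (trans (*-congˡ (sym xᵃ≈g)) (geo-absorbs x N xᴺ≈1 a))) ⟩
    G - G              ≈⟨ -‿inverseʳ G ⟩
    0#                 ∎
    where
    G : Carrier
    G = geo x N

  one-minus-root-divides : ∀ x N v → x ^ N ≈ 1# → geo x N * v ≈ 0# →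
    (1# - x) * wsum x N * v ≈ (- (N × 1#)) * v
  one-minus-root-divides x N v xᴺ≈1 Gv≈0 = begin
    (1# - x) * W * v    ≈⟨ inverseˡ-unique _ _ DNv≈0 ⟩
    - ((N × 1#) * v)    ≈⟨ -‿distribˡ-* (N × 1#) v ⟩
    (- (N × 1#)) * v    ∎
    where
    W : Carrier
    W = wsum x N
    G : Carrier
    G = geo x N
    D+N≈G : (1# - x) * W + N × 1# ≈ G
    D+N≈G = +-cancelʳ 1# (begin
      (1# - x) * W + N × 1# + 1#  ≈⟨ +-congʳ (+-congˡ (×-congʳ N (sym xᴺ≈1))) ⟩
      (1# - x) * W + N × x ^ N + 1# ≈⟨ wsum-telescope x N ⟩
      G + x ^ N                   ≈⟨ +-congˡ xᴺ≈1 ⟩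
      G + 1#                      ∎)
    DNv≈0 : (1# - x) * W * v + (N × 1#) * v ≈ 0#
    DNv≈0 = trans (sym (distribʳ v _ _)) (trans (*-congʳ D+N≈G) Gv≈0)

  product-annihilated : ∀ {K} (F : Fin K → Carrier) y k → y * F k ≈ 0# → y * product F ≈ 0#
  product-annihilated {suc K} F y fzero    yF≈0 = trans (sym (*-assoc y _ _)) (trans (*-congʳ yF≈0) (zeroˡ _))
  product-annihilated {suc K} F y (fsuc k) yF≈0 = begin
    y * (F fzero * product (F ∘ fsuc)) ≈⟨ solve 3 (λ y a b → y :* (a :* b) := a :* (y :* b)) refl y (F fzero) _ ⟩
    F fzero * (y * product (F ∘ fsuc)) ≈⟨ *-congˡ (product-annihilated (F ∘ fsuc) y k yF≈0) ⟩
    F fzero * 0#                       ≈⟨ zeroʳ _ ⟩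
    0#                                 ∎

  ∏roots-divides : ∀ v u xs → All (λ ρ → Σ Carrier (λ w → (1# - ρ) * w * v ≈ u * v)) xs →
    Σ Carrier (λ W → ∏roots xs 1# * W * v ≈ u ^ length xs * v)
  ∏roots-divides v u []       []                 = 1# , *-congʳ (*-identityˡ 1#)
  ∏roots-divides v u (ρ ∷ xs) ((w , eq) ∷ rest) with ∏roots-divides v u xs rest
  ... | W , eqs = w * W , (begin
    (1# - ρ) * P * (w * W) * v  ≈⟨ solve 5 (λ A P w W v → A :* P :* (w :* W) :* v := A :* w :* (P :* W :* v)) refl (1# - ρ) P w W v ⟩
    (1# - ρ) * w * (P * W * v)  ≈⟨ *-congˡ eqs ⟩
    (1# - ρ) * w * (U * v)      ≈⟨ solve 4 (λ A w U v → A :* w :* (U :* v) := U :* (A :* w :* v)) refl (1# - ρ) w U v ⟩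
    U * ((1# - ρ) * w * v)      ≈⟨ *-congˡ eq ⟩
    U * (u * v)                 ≈⟨ solve 3 (λ U u v → U :* (u :* v) := u :* U :* v) refl U u v ⟩
    u * U * v                   ∎)
    where
    P : Carrier
    P = ∏roots xs 1#
    U : Carrier
    U = u ^ length xs

  column-identity : ∀ {r q} (c : Fin r → Carrier) (a : Fin r → Fin q → Carrier) (g : Fin q → Carrier) λ′ →
    ∑[ i < q ] (∑[ j < r ] (c j * a j i) * g i + ∑[ j < r ] (c j * - a j i) * (λ′ * g i))
    ≈ ∑[ j < r ] (c j * ((1# - λ′) * ∑[ i < q ] (a j i * g i)))
  column-identity {r} {q} c a g λ′ = begin
    ∑[ i < q ] (∑[ j < r ] (c j * a j i) * g i + ∑[ j < r ] (c j * - a j i) * (λ′ * g i))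
      ≈⟨ sum-cong-≋ (λ i → trans (+-cong (*-distribʳ-sum (g i) (λ j → c j * a j i)) (*-distribʳ-sum (λ′ * g i) (λ j → c j * - a j i)))
                                (sym (∑-distrib-+ (λ j → c j * a j i * g i) (λ j → c j * - a j i * (λ′ * g i))))) ⟩
    ∑[ i < q ] ∑[ j < r ] (c j * a j i * g i + c j * - a j i * (λ′ * g i))
      ≈⟨ ∑-comm (λ i j → c j * a j i * g i + c j * - a j i * (λ′ * g i)) ⟩
    ∑[ j < r ] ∑[ i < q ] (c j * a j i * g i + c j * - a j i * (λ′ * g i))
      ≈⟨ sum-cong-≋ (λ j → trans (sum-cong-≋ (λ i → regroup (c j) (a j i) (g i)))
                                (sym (*-distribˡ-sum (c j) (λ i → (1# - λ′) * (a j i * g i))))) ⟩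
    ∑[ j < r ] (c j * ∑[ i < q ] ((1# - λ′) * (a j i * g i)))
      ≈⟨ sum-cong-≋ (λ j → *-congˡ (sym (*-distribˡ-sum (1# - λ′) (λ i → a j i * g i)))) ⟩
    ∑[ j < r ] (c j * ((1# - λ′) * ∑[ i < q ] (a j i * g i))) ∎
    where
    regroup : ∀ s b h → s * b * h + s * - b * (λ′ * h) ≈ s * ((1# - λ′) * (b * h))
    regroup s b h = begin
      s * b * h + s * - b * (λ′ * h)     ≈⟨ +-congˡ (*-congʳ (sym (-‿distribʳ-* s b))) ⟩
      s * b * h + - (s * b) * (λ′ * h)   ≈⟨ +-congˡ (sym (-‿distribˡ-* (s * b) (λ′ * h))) ⟩
      s * b * h - s * b * (λ′ * h)
        ≈⟨ +-congˡ (-‿cong (solve 4 (λ s b l h → s :* b :* (l :* h) := s :* (l :* (b :* h))) refl s b λ′ h)) ⟩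
      s * b * h - s * (λ′ * (b * h))     ≈⟨ +-congˡ (-‿distribʳ-* s _) ⟩
      s * b * h + s * - (λ′ * (b * h))   ≈⟨ +-cong (*-assoc s b h) (*-congˡ (-‿distribˡ-* λ′ (b * h))) ⟩
      s * (b * h) + s * ((- λ′) * (b * h)) ≈⟨ sym (distribˡ s _ _) ⟩
      s * (b * h + (- λ′) * (b * h))
        ≈⟨ *-congˡ (solve 3 (λ nl b h → b :* h :+ nl :* (b :* h) := (con 1 :+ nl) :* (b :* h)) refl (- λ′) b h) ⟩
      s * ((1# - λ′) * (b * h))          ∎

-- Boolean vectors of length s, i.e. subsets of an s-element set.
module BooleanVectors where

  open import Data.Nat using (zero; _+_; _^_)
  open import Data.Nat.Properties using (+-identityʳ)
  open import Data.Bool using (Bool; true; false)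
  open import Data.Vec using (Vec; []; _∷_; lookup)
  open import Data.Fin using (Fin) renaming (zero to fzero; suc to fsuc)
  open import Data.List using (List; []; _∷_; _++_; map; length)
  open import Data.List.Properties using (length-++; length-map)
  open import Data.List.Membership.Propositional using (_∈_)
  open import Data.List.Membership.Propositional.Properties using (∈-++⁺ˡ; ∈-++⁺ʳ; ∈-map⁺)
  open import Data.List.Relation.Unary.Any using (here)
  open import Data.List.Relation.Unary.All as All using (All)
  open import Data.List.Relation.Unary.All.Properties using (++⁺; map⁺)
  open import Data.Product using (Σ; _,_)
  open import Relation.Binary.PropositionalEquality

  Nonzero : ∀ {s} → Vec Bool s → Set
  Nonzero {s} T = Σ (Fin s) (λ k → lookup T k ≡ true)

  allVectors : ∀ s → List (Vec Bool s)
  allVectors zero    = [] ∷ []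
  allVectors (suc s) = map (false ∷_) (allVectors s) ++ map (true ∷_) (allVectors s)

  nonzeroVectors : ∀ s → List (Vec Bool s)
  nonzeroVectors zero    = []
  nonzeroVectors (suc s) = map (false ∷_) (nonzeroVectors s) ++ map (true ∷_) (allVectors s)

  ∈-allVectors : ∀ {s} (T : Vec Bool s) → T ∈ allVectors s
  ∈-allVectors []               = here refl
  ∈-allVectors {suc s} (false ∷ T) = ∈-++⁺ˡ (∈-map⁺ (false ∷_) (∈-allVectors T))
  ∈-allVectors {suc s} (true ∷ T)  = ∈-++⁺ʳ (map (false ∷_) (allVectors s)) (∈-map⁺ (true ∷_) (∈-allVectors T))

  ∈-nonzeroVectors : ∀ {s} (T : Vec Bool s) → Nonzero T → T ∈ nonzeroVectors s
  ∈-nonzeroVectors {suc s} (true ∷ T)  _             =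
    ∈-++⁺ʳ (map (false ∷_) (nonzeroVectors s)) (∈-map⁺ (true ∷_) (∈-allVectors T))
  ∈-nonzeroVectors {suc s} (false ∷ T) (fsuc k , Tₖ) = ∈-++⁺ˡ (∈-map⁺ (false ∷_) (∈-nonzeroVectors T (k , Tₖ)))

  nonzeroVectors-nonzero : ∀ s → All Nonzero (nonzeroVectors s)
  nonzeroVectors-nonzero zero    = All.[]
  nonzeroVectors-nonzero (suc s) =
    ++⁺ (map⁺ (All.map (λ (k , Tₖ) → fsuc k , Tₖ) (nonzeroVectors-nonzero s)))
        (map⁺ (All.tabulate (λ _ → fzero , refl)))

  length-allVectors : ∀ s → length (allVectors s) ≡ 2 ^ s
  length-allVectors zero    = refl
  length-allVectors (suc s) = begin
    length (map (false ∷_) A ++ map (true ∷_) A)         ≡⟨ length-++ (map (false ∷_) A) ⟩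
    length (map (false ∷_) A) + length (map (true ∷_) A) ≡⟨ cong₂ _+_ (length-map _ A) (length-map _ A) ⟩
    length A + length A                                  ≡⟨ cong₂ _+_ (length-allVectors s) 2ˢ≡2ˢ+0 ⟩
    2 ^ s + (2 ^ s + 0)                                  ∎
    where
    open ≡-Reasoning
    A : List (Vec Bool s)
    A = allVectors s
    2ˢ≡2ˢ+0 : length A ≡ 2 ^ s + 0
    2ˢ≡2ˢ+0 = trans (length-allVectors s) (sym (+-identityʳ _))

  length-nonzeroVectors : ∀ s → suc (length (nonzeroVectors s)) ≡ 2 ^ s
  length-nonzeroVectors zero    = refl
  length-nonzeroVectors (suc s) = begin
    suc (length (map (false ∷_) N ++ map (true ∷_) A))          ≡⟨ cong suc (length-++ (map (false ∷_) N)) ⟩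
    suc (length (map (false ∷_) N) + length (map (true ∷_) A))  ≡⟨ cong suc (cong₂ _+_ (length-map _ N) (length-map _ A)) ⟩
    suc (length N) + length A                                   ≡⟨ cong₂ _+_ (length-nonzeroVectors s) 2ˢ≡2ˢ+0 ⟩
    2 ^ s + (2 ^ s + 0)                                         ∎
    where
    open ≡-Reasoning
    A : List (Vec Bool s)
    A = allVectors s
    N : List (Vec Bool s)
    N = nonzeroVectors s
    2ˢ≡2ˢ+0 : length A ≡ 2 ^ s + 0
    2ˢ≡2ˢ+0 = trans (length-allVectors s) (sym (+-identityʳ _))

module FinCases where

  open import Data.Fin using (punchIn; punchOut)
  open import Data.Fin.Properties using (_≟_; punchIn-punchOut)
  open import Relation.Nullary using (yes; no)
  open import Relation.Binary.PropositionalEquality using (refl; subst; sym)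
  open import Function using (_∘_)

  indexCases : ∀ {s ℓ} (P : Fin (suc s) → Set ℓ) j → P j → (∀ k → P (punchIn j k)) → ∀ t → P t
  indexCases P j Pj Pk t with t ≟ j
  ... | yes refl = Pj
  ... | no t≢j   = subst P (punchIn-punchOut (t≢j ∘ sym)) (Pk (punchOut (t≢j ∘ sym)))

module GroupRing (n : ℕ) where

  open import Data.Nat using (_+_; _*_; _∸_; _≡ᵇ_)
  open import Data.Nat.Properties
    using (+-identityʳ; +-assoc; +-comm; *-comm; *-assoc; *-zeroʳ; *-distribˡ-+; ≤-trans; <⇒≤; m≤n+m; m∸n+n≡m)
  open import Data.Nat.DivMod using (_%_; m%n<n)
  open import Data.Nat.Divisibility using (∣-refl; m∣m*n)
  open import Data.Fin using (toℕ)
  open import Data.Fin.Properties using (toℕ-injective; toℕ<n; toℕ-fromℕ<)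
  open import Data.Bool using (Bool; true; false; if_then_else_)
  open import Data.Product using (_,_)
  open import Level using (0ℓ)
  open import Algebra.Bundles using (CommutativeRing)
  open import Algebra.Structures using (IsCommutativeRing)
  open import Relation.Binary.Structures using (IsEquivalence)
  open import Relation.Binary.PropositionalEquality
  open FinSum

  -- We write m = n + 1, so that n represents −1 modulo m.
  m : ℕ
  m = suc n

  open Congruence m

  toℕ-idx : ∀ j → toℕ (idx m j) ≡ j % m
  toℕ-idx j = toℕ-fromℕ< (m%n<n j m)

  idx-≋ : ∀ j → toℕ (idx m j) ≋ j
  idx-≋ j = ≋-trans (≡⇒≋ (toℕ-idx j)) (%-≋ j)

  fin-≋ : ∀ {a b : Fin m} → toℕ a ≋ toℕ b → a ≡ b
  fin-≋ {a} {b} a≋b = toℕ-injective (≋⇒≡ (toℕ<n a) (toℕ<n b) a≋b)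

  infixl 6 _⊟_ _⊞_
  _⊟_ : Fin m → Fin m → Fin m
  k ⊟ i = idx m (toℕ k + m ∸ toℕ i)

  _⊞_ : Fin m → Fin m → Fin m
  i ⊞ j = idx m (toℕ i + toℕ j)

  ⊟-spec : ∀ k i → toℕ (k ⊟ i) + toℕ i ≋ toℕ k
  ⊟-spec k i = begin
    toℕ (k ⊟ i) + toℕ i       ≈⟨ ≋-+ (idx-≋ (toℕ k + m ∸ toℕ i)) ≋-refl ⟩
    toℕ k + m ∸ toℕ i + toℕ i ≡⟨ m∸n+n≡m (≤-trans (<⇒≤ (toℕ<n i)) (m≤n+m m (toℕ k))) ⟩
    toℕ k + m                 ≈⟨ ≋-+ (≋-refl {toℕ k}) (∣⇒≋0 ∣-refl) ⟩
    toℕ k + 0                 ≡⟨ +-identityʳ (toℕ k) ⟩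
    toℕ k                     ∎
    where
    open import Relation.Binary.Reasoning.Setoid ≋-setoid

  ⊟-unique : ∀ {a k i} → toℕ a + toℕ i ≋ toℕ k → a ≡ k ⊟ i
  ⊟-unique {a} {k} {i} a+i≋k = fin-≋ (≋-cancelʳ (toℕ i) (≋-trans a+i≋k (≋-sym (⊟-spec k i))))

  ⊟-involutive : ∀ k i → k ⊟ (k ⊟ i) ≡ i
  ⊟-involutive k i = sym (⊟-unique (≋-trans (≡⇒≋ (+-comm (toℕ i) _)) (⊟-spec k i)))

  ⊟-⊞ : ∀ i j → (i ⊞ j) ⊟ j ≡ i
  ⊟-⊞ i j = sym (⊟-unique {i} {i ⊞ j} {j} (≋-sym (idx-≋ _)))

  ⊞-⊟ : ∀ i j → (i ⊟ j) ⊞ j ≡ i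
  ⊞-⊟ i j = fin-≋ (≋-trans (idx-≋ _) (⊟-spec i j))

  ⊟-⊞-assoc : ∀ k i j → k ⊟ (i ⊞ j) ≡ (k ⊟ j) ⊟ i
  ⊟-⊞-assoc k i j = sym (⊟-unique (≋-trans (≋-+ (≋-refl {toℕ ((k ⊟ j) ⊟ i)}) (idx-≋ (toℕ i + toℕ j)))
    (≋-trans (≡⇒≋ (sym (+-assoc (toℕ ((k ⊟ j) ⊟ i)) (toℕ i) (toℕ j))))
    (≋-trans (≋-+ (⊟-spec (k ⊟ j) i) (≋-refl {toℕ j})) (⊟-spec k j)))))

  infixl 7 _*ᶜ_
  infixl 6 _+ᶜ_
  _*ᶜ_ _+ᶜ_ : R m → R m → R m
  _*ᶜ_ = _*R_ m
  _+ᶜ_ = _+R_ m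

  -- commutativity: reindex along the involution i ↦ k − i
  *ᶜ-comm : ∀ f g k → (f *ᶜ g) k ≡ (g *ᶜ f) k
  *ᶜ-comm f g k = trans (Σ-reindex m (λ i → f i * g (k ⊟ i)) (k ⊟_) (k ⊟_) (⊟-involutive k) (⊟-involutive k))
    (Σ-cong m (λ i → trans (cong (λ z → f (k ⊟ i) * g z) (⊟-involutive k i)) (*-comm (f (k ⊟ i)) (g i))))

  -- associativity: exchange the sums and shift the inner index by j
  *ᶜ-assoc : ∀ f g h k → ((f *ᶜ g) *ᶜ h) k ≡ (f *ᶜ (g *ᶜ h)) k
  *ᶜ-assoc f g h k = begin
    Σfin m (λ i → Σfin m (λ j → f j * g (i ⊟ j)) * h (k ⊟ i))
      ≡⟨ Σ-cong m (λ i → sym (Σ-*ʳ m (h (k ⊟ i)) (λ j → f j * g (i ⊟ j)))) ⟩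
    Σfin m (λ i → Σfin m (λ j → f j * g (i ⊟ j) * h (k ⊟ i)))
      ≡⟨ Σ-swap m m (λ i j → f j * g (i ⊟ j) * h (k ⊟ i)) ⟩
    Σfin m (λ j → Σfin m (λ i → f j * g (i ⊟ j) * h (k ⊟ i)))
      ≡⟨ Σ-cong m (λ j → Σ-cong m (λ i → *-assoc (f j) (g (i ⊟ j)) (h (k ⊟ i)))) ⟩
    Σfin m (λ j → Σfin m (λ i → f j * (g (i ⊟ j) * h (k ⊟ i))))
      ≡⟨ Σ-cong m (λ j → Σ-*ˡ m (f j) (λ i → g (i ⊟ j) * h (k ⊟ i))) ⟩
    Σfin m (λ j → f j * Σfin m (λ i → g (i ⊟ j) * h (k ⊟ i)))
      ≡⟨ Σ-cong m (λ j → cong (f j *_)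
           (Σ-reindex m (λ i → g (i ⊟ j) * h (k ⊟ i)) (_⊞ j) (_⊟ j) (λ i → ⊞-⊟ i j) (λ i → ⊟-⊞ i j))) ⟩
    Σfin m (λ j → f j * Σfin m (λ i → g ((i ⊞ j) ⊟ j) * h (k ⊟ (i ⊞ j))))
      ≡⟨ Σ-cong m (λ j → cong (f j *_) (Σ-cong m (λ i → cong₂ (λ a b → g a * h b) (⊟-⊞ i j) (⊟-⊞-assoc k i j)))) ⟩
    Σfin m (λ j → f j * Σfin m (λ i → g i * h ((k ⊟ j) ⊟ i))) ∎
    where open ≡-Reasoning

  *ᶜ-distribˡ : ∀ f g h k → (f *ᶜ (g +ᶜ h)) k ≡ (f *ᶜ g +ᶜ f *ᶜ h) k
  *ᶜ-distribˡ f g h k = trans (Σ-cong m (λ i → *-distribˡ-+ (f i) (g (k ⊟ i)) (h (k ⊟ i))))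
    (Σ-+ m (λ i → f i * g (k ⊟ i)) (λ i → f i * h (k ⊟ i)))

  *ᶜ-distribʳ : ∀ f g h k → ((g +ᶜ h) *ᶜ f) k ≡ (g *ᶜ f +ᶜ h *ᶜ f) k
  *ᶜ-distribʳ f g h k = trans (*ᶜ-comm (g +ᶜ h) f k)
    (trans (*ᶜ-distribˡ f g h k) (cong₂ _+_ (*ᶜ-comm f g k) (*ᶜ-comm f h k)))

  *ᶜ-congʳ : ∀ {f f′} g → (∀ k → f k ≡ f′ k) → ∀ k → (f *ᶜ g) k ≡ (f′ *ᶜ g) k
  *ᶜ-congʳ g f≗f′ k = Σ-cong m (λ i → cong (_* g (k ⊟ i)) (f≗f′ i))

  if-*ʳ : ∀ (b : Bool) c y → (if b then c else 0) * y ≡ (if b then c * y else 0)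
  if-*ʳ true  c y = refl
  if-*ʳ false c y = refl

  if-*ˡ : ∀ (b : Bool) c y → c * (if b then y else 0) ≡ (if b then c * y else 0)
  if-*ˡ true  c y = refl
  if-*ˡ false c y = *-zeroʳ c

  mono-*ᶜ : ∀ c e f k → (mono m c e *ᶜ f) k ≡ c * f (k ⊟ idx m e)
  mono-*ᶜ c e f k = trans (Σ-cong m (λ i → if-*ʳ (toℕ i ≡ᵇ e % m) c (f (k ⊟ i))))
    (Σ-delta m (λ i → c * f (k ⊟ i)) (idx m e) (toℕ-idx e))

  k⊟0 : ∀ k → k ⊟ idx m 0 ≡ k
  k⊟0 k = sym (⊟-unique (≡⇒≋ (trans (cong (toℕ k +_) (toℕ-idx 0)) (+-identityʳ (toℕ k)))))

  -- the unit γ^0 and negation, using n ≡ −1 (mod m)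
  1ᶜ : R m
  1ᶜ = mono m 1 0

  -ᶜ_ : R m → R m
  (-ᶜ f) k = n * f k

  1ᶜ-*ᶜ : ∀ f k → (1ᶜ *ᶜ f) k ≡ f k
  1ᶜ-*ᶜ f k = trans (mono-*ᶜ 1 0 f k) (trans (+-identityʳ _) (cong f (k⊟0 k)))

  -- Equality of R m, wrapped in a record so that both sides are inferable.
  infix 4 _≈_
  record _≈_ (f g : R m) : Set where
    constructor wrap
    field unwrap : _≈R_ m f g
  open _≈_ public

  ≗⇒≈ : ∀ {f g} → (∀ k → f k ≡ g k) → f ≈ g
  ≗⇒≈ f≗g = wrap (λ k → cong (_% m) (f≗g k))

  ≈-isEquivalence : IsEquivalence _≈_
  ≈-isEquivalence = record
    { refl  = wrap (λ k → refl)
    ; sym   = λ (wrap e) → wrap (λ k → sym (e k))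
    ; trans = λ (wrap e) (wrap f) → wrap (λ k → trans (e k) (f k))
    }

  +ᶜ-cong : ∀ {f f′ g g′} → f ≈ f′ → g ≈ g′ → (f +ᶜ g) ≈ (f′ +ᶜ g′)
  +ᶜ-cong {f} {f′} {g} {g′} (wrap e) (wrap e′) =
    wrap (λ k → un≋ (≋-+ (mk≋ {f k} {f′ k} (e k)) (mk≋ {g k} {g′ k} (e′ k))))

  *ᶜ-cong : ∀ {f f′ g g′} → f ≈ f′ → g ≈ g′ → (f *ᶜ g) ≈ (f′ *ᶜ g′)
  *ᶜ-cong {f} {f′} {g} {g′} (wrap e) (wrap e′) = wrap (λ k →
    un≋ (Σ-≋ m (λ i → f i * g (k ⊟ i)) (λ i → f′ i * g′ (k ⊟ i))
      (λ i → ≋-* (mk≋ {f i} {f′ i} (e i)) (mk≋ {g (k ⊟ i)} {g′ (k ⊟ i)} (e′ (k ⊟ i))))))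

  -ᶜ-cong : ∀ {f g} → f ≈ g → (-ᶜ f) ≈ (-ᶜ g)
  -ᶜ-cong {f} {g} (wrap e) = wrap (λ k → un≋ (≋-* (≋-refl {n}) (mk≋ {f k} {g k} (e k))))

  -ᶜ-inverseʳ : ∀ f → (f +ᶜ -ᶜ f) ≈ 0R m
  -ᶜ-inverseʳ f = wrap (λ k → un≋ (∣⇒≋0 (m∣m*n (f k))))

  -- The ring operations are kept abstract: elements of R m then behave as
  -- opaque ring elements, and the convolution sums are never unfolded
  -- during type checking of the ring-level reasoning below.
  infixl 7 _⊗_
  infixl 6 _⊕_
  abstract
    _⊕_ _⊗_ : R m → R m → R m
    f ⊕ g = f +ᶜ g
    f ⊗ g = f *ᶜ g
    ⊖_ : R m → R m
    ⊖ f = -ᶜ f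

    ⊕-def : ∀ f g k → (f ⊕ g) k ≡ (f +ᶜ g) k
    ⊕-def f g k = refl
    ⊗-def : ∀ f g k → (f ⊗ g) k ≡ (f *ᶜ g) k
    ⊗-def f g k = refl
    ⊖-def : ∀ f k → (⊖ f) k ≡ n * f k
    ⊖-def f k = refl

    isCommutativeRing : IsCommutativeRing _≈_ _⊕_ _⊗_ ⊖_ (0R m) 1ᶜ
    isCommutativeRing = record
      { isRing = record
        { +-isAbelianGroup = record
          { isGroup = record
            { isMonoid = record
              { isSemigroup = record
                { isMagma = record { isEquivalence = ≈-isEquivalence ; ∙-cong = +ᶜ-cong }
                ; assoc = λ f g h → ≗⇒≈ (λ k → +-assoc (f k) (g k) (h k)) }
              ; identity = (λ f → ≗⇒≈ (λ k → refl)) , (λ f → ≗⇒≈ (λ k → +-identityʳ (f k))) }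
            ; inverse = (λ f → ≈-trans (≗⇒≈ (λ k → +-comm (n * f k) (f k))) (-ᶜ-inverseʳ f)) , -ᶜ-inverseʳ
            ; ⁻¹-cong = -ᶜ-cong }
          ; comm = λ f g → ≗⇒≈ (λ k → +-comm (f k) (g k)) }
        ; *-cong = *ᶜ-cong
        ; *-assoc = λ f g h → ≗⇒≈ (*ᶜ-assoc f g h)
        ; *-identity = (λ f → ≗⇒≈ (1ᶜ-*ᶜ f)) , (λ f → ≗⇒≈ (λ k → trans (*ᶜ-comm f 1ᶜ k) (1ᶜ-*ᶜ f k)))
        ; distrib = (λ f g h → ≗⇒≈ (*ᶜ-distribˡ f g h)) , (λ f g h → ≗⇒≈ (*ᶜ-distribʳ f g h)) }
      ; *-comm = λ f g → ≗⇒≈ (*ᶜ-comm f g) }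
      where open IsEquivalence ≈-isEquivalence using () renaming (trans to ≈-trans)

  ℛ : CommutativeRing 0ℓ 0ℓ
  ℛ = record { isCommutativeRing = isCommutativeRing }

module RingElements (n : ℕ) where

  open import Data.Nat using (zero; suc; _+_; _*_; _^_; _≡ᵇ_; NonZero)
  open import Data.Nat.Properties using (+-comm; *-identityʳ; *-zeroʳ; +-identityʳ; ≡ᵇ⇒≡; ≡⇒≡ᵇ)
  open import Data.Nat.DivMod using (_%_; m%n<n)
  open import Data.Nat.Divisibility using (_∣_; _∣0; ∣m⇒∣m*n; ∣m∣n⇒∣m+n; ∣m+n∣m⇒∣n)
  open import Data.Nat.Primality using (Prime; euclidsLemma)
  open import Data.Fin using (Fin; toℕ) renaming (zero to fzero; suc to fsuc)
  open import Data.Fin.Properties using (toℕ<n; suc-injective)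
  open import Data.Bool using (Bool; true; false; if_then_else_; T)
  open import Data.Sum using (inj₁; inj₂)
  open import Data.Empty using (⊥-elim)
  open import Relation.Nullary using (¬_)
  open import Relation.Binary.PropositionalEquality
    using (_≡_; _≢_; refl; sym; trans; cong; cong₂; subst; module ≡-Reasoning)
  open import Function using (_∘_)
  open GroupRing n
  open Congruence m
  open FinSum using (Σ-∣)

  open import Algebra.Bundles using (CommutativeRing)
  module ℛ = CommutativeRing ℛ
  open import Algebra.Properties.Semiring.Sum ℛ.semiring public using (sum; sum-syntax; sum-cong-≋; *-distribˡ-sum)
  open import Algebra.Properties.CommutativeMonoid.Sum ℛ.*-commutativeMonoid public using () renaming (sum to product)
  open import Algebra.Properties.Semiring.Exp ℛ.semiring public using () renaming (_^_ to _^ᴿ_; ^-congˡ to ^ᴿ-congˡ)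
  open import Algebra.Properties.Semiring.Mult ℛ.semiring public using () renaming (_×_ to _×ᴿ_)

  γ : ℕ → R m
  γ e = mono m 1 e

  ⟪_⟫ : ℕ → R m
  ⟪ c ⟫ = mono m c 0

  indicator-cong : ∀ c {x y u v} → (x ≡ y → u ≡ v) → (u ≡ v → x ≡ y) →
    (if x ≡ᵇ y then c else 0) ≡ (if u ≡ᵇ v then c else 0)
  indicator-cong c {x} {y} {u} {v} ⇒ ⇐ with x ≡ᵇ y in e₁ | u ≡ᵇ v in e₂
  ... | true  | true  = refl
  ... | false | false = refl
  ... | true  | false = ⊥-elim (subst T e₂ (≡⇒≡ᵇ u v (⇒ (≡ᵇ⇒≡ x y (subst T (sym e₁) _)))))
  ... | false | true  = ⊥-elim (subst T e₁ (≡⇒≡ᵇ x y (⇐ (≡ᵇ⇒≡ u v (subst T (sym e₂) _)))))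

  ⟪⟫-⊗ : ∀ c f k → (⟪ c ⟫ ⊗ f) k ≡ c * f k
  ⟪⟫-⊗ c f k = trans (⊗-def ⟪ c ⟫ f k) (trans (mono-*ᶜ c 0 f k) (cong (λ z → c * f z) (k⊟0 k)))

  mono≈⟪⟫⊗γ : ∀ c e → mono m c e ≈ ⟪ c ⟫ ⊗ γ e
  mono≈⟪⟫⊗γ c e = ≗⇒≈ (λ k → sym (trans (⟪⟫-⊗ c (γ e) k)
    (trans (if-*ˡ (toℕ k ≡ᵇ e % m) c 1) (cong (λ z → if toℕ k ≡ᵇ e % m then z else 0) (*-identityʳ c)))))

  ⟪⟫-* : ∀ a b → ⟪ a ⟫ ⊗ ⟪ b ⟫ ≈ ⟪ a * b ⟫
  ⟪⟫-* a b = ≗⇒≈ (λ k → trans (⟪⟫-⊗ a ⟪ b ⟫ k) (if-*ˡ (toℕ k ≡ᵇ 0) a b))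

  ⟪⟫-+ : ∀ a b → ⟪ a ⟫ ⊕ ⟪ b ⟫ ≈ ⟪ a + b ⟫
  ⟪⟫-+ a b = ≗⇒≈ (λ k → trans (⊕-def ⟪ a ⟫ ⟪ b ⟫ k) (if-+ (toℕ k ≡ᵇ 0)))
    where
    if-+ : ∀ (b′ : Bool) → (if b′ then a else 0) + (if b′ then b else 0) ≡ (if b′ then a + b else 0)
    if-+ true  = refl
    if-+ false = refl

  ⟪⟫-cong : ∀ {a b} → a ≋ b → ⟪ a ⟫ ≈ ⟪ b ⟫
  ⟪⟫-cong {a} {b} (mk≋ a≡b) = wrap (λ k → lemma (toℕ k ≡ᵇ 0))
    where
    lemma : ∀ b′ → (if b′ then a else 0) % m ≡ (if b′ then b else 0) % m
    lemma true  = a≡b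
    lemma false = refl

  ⟪⟫≈0 : ∀ {a} → a ≋ 0 → ⟪ a ⟫ ≈ ℛ.0#
  ⟪⟫≈0 {a} a≋0 = ℛ.trans (⟪⟫-cong a≋0) (wrap (λ k → lemma (toℕ k ≡ᵇ 0)))
    where
    lemma : ∀ b → (if b then 0 else 0) % m ≡ 0 % m
    lemma true  = refl
    lemma false = refl

  -- −f is n·f, since n ≡ −1 modulo m
  ⊖≈⟪n⟫⊗ : ∀ f → ⊖ f ≈ ⟪ n ⟫ ⊗ f
  ⊖≈⟪n⟫⊗ f = ≗⇒≈ (λ k → trans (⊖-def f k) (sym (⟪⟫-⊗ n f k)))

  1-⟪⟫ : ∀ ℓ → 1ᶜ ⊕ ⊖ ⟪ ℓ ⟫ ≈ ⟪ 1 + n * ℓ ⟫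
  1-⟪⟫ ℓ = ≗⇒≈ (λ k → trans (⊕-def 1ᶜ (⊖ ⟪ ℓ ⟫) k)
    (trans (cong (1ᶜ k +_) (⊖-def ⟪ ℓ ⟫ k)) (lemma (toℕ k ≡ᵇ 0))))
    where
    lemma : ∀ b → (if b then 1 else 0) + n * (if b then ℓ else 0) ≡ (if b then 1 + n * ℓ else 0)
    lemma true  = refl
    lemma false = cong (0 +_) (*-zeroʳ n)

  ×ᴿ1≈⟪⟫ : ∀ N → N ×ᴿ ℛ.1# ≈ ⟪ N ⟫
  ×ᴿ1≈⟪⟫ zero    = ℛ.sym (⟪⟫≈0 ≋-refl)
  ×ᴿ1≈⟪⟫ (suc N) = ℛ.trans (ℛ.+-congˡ (×ᴿ1≈⟪⟫ N)) (⟪⟫-+ 1 N)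

  ^ᴿ-⟪⟫ : ∀ c i → ⟪ c ⟫ ^ᴿ i ≈ ⟪ c ^ i ⟫
  ^ᴿ-⟪⟫ c zero    = ℛ.refl
  ^ᴿ-⟪⟫ c (suc i) = ℛ.trans (ℛ.*-congˡ (^ᴿ-⟪⟫ c i)) (⟪⟫-* c (c ^ i))

  -- γ^a γ^b = γ^(a+b): the coefficient at k is 1 exactly when k − a ≡ b, i.e. k ≡ a + b
  γ-+ : ∀ a b → γ a ⊗ γ b ≈ γ (a + b)
  γ-+ a b = ≗⇒≈ (λ k → trans (⊗-def (γ a) (γ b) k) (trans (mono-*ᶜ 1 a (γ b) k) (trans (+-identityʳ _)
    (indicator-cong 1 (⇒ k) (⇐ k)))))
    where
    spec : ∀ k → toℕ (k ⊟ idx m a) + a ≋ toℕ k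
    spec k = ≋-trans (≋-+ (≋-refl {toℕ (k ⊟ idx m a)}) (≋-sym (idx-≋ a))) (⊟-spec k (idx m a))
    ⇒ : ∀ k → toℕ (k ⊟ idx m a) ≡ b % m → toℕ k ≡ (a + b) % m
    ⇒ k e = ≋⇒≡ (toℕ<n k) (m%n<n (a + b) m) (≋-trans (≋-sym (spec k))
      (≋-trans (≋-+ (≋-trans (≡⇒≋ e) (%-≋ b)) (≋-refl {a})) (≋-trans (≡⇒≋ (+-comm b a)) (≋-sym (%-≋ (a + b))))))
    ⇐ : ∀ k → toℕ k ≡ (a + b) % m → toℕ (k ⊟ idx m a) ≡ b % m
    ⇐ k e = ≋⇒≡ (toℕ<n (k ⊟ idx m a)) (m%n<n b m) (≋-cancelʳ a (≋-trans (spec k)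
      (≋-trans (≡⇒≋ e) (≋-trans (%-≋ (a + b)) (≋-trans (≡⇒≋ (+-comm a b)) (≋-+ (≋-sym (%-≋ b)) (≋-refl {a})))))))

  γ-≋ : ∀ {a b} → a ≋ b → γ a ≈ γ b
  γ-≋ (mk≋ a≡b) = ≗⇒≈ (λ k → cong (λ z → if toℕ k ≡ᵇ z then 1 else 0) a≡b)

  γ-^ : ∀ ℓ i → γ ℓ ^ᴿ i ≈ γ (i * ℓ)
  γ-^ ℓ zero    = ℛ.refl
  γ-^ ℓ (suc i) = ℛ.trans (ℛ.*-congˡ (γ-^ ℓ i)) (γ-+ ℓ (i * ℓ))

  sumR≈sum : ∀ q (f : Fin q → R m) → sumR m q f ≈ sum f
  sumR≈sum q f = ≗⇒≈ (go q f)
    where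
    go : ∀ q (f : Fin q → R m) k → sumR m q f k ≡ sum f k
    go zero    f k = refl
    go (suc q) f k = trans (cong (f fzero k +_) (go q (f ∘ fsuc) k)) (sym (⊕-def (f fzero) (sum (f ∘ fsuc)) k))

  module Multiples (d : ℕ) .{{_ : NonZero d}} (d∣m : d ∣ m) where

    Divisible : R m → Set
    Divisible f = ∀ k → d ∣ f k

    Divisible-≈ : ∀ {f g} → f ≈ g → Divisible f → Divisible g
    Divisible-≈ {f} {g} (wrap f≈g) d∣f k = ≋-∣ d∣m (mk≋ (f≈g k)) (d∣f k)

    Divisible-⊗ˡ : ∀ f g → Divisible f → Divisible (f ⊗ g)
    Divisible-⊗ˡ f g d∣f k = subst (d ∣_) (sym (⊗-def f g k))
      (Σ-∣ m (λ i → f i * g (k ⊟ i)) (λ i → ∣m⇒∣m*n (g (k ⊟ i)) (d∣f i)))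

    Divisible-⊗ʳ : ∀ f g → Divisible g → Divisible (f ⊗ g)
    Divisible-⊗ʳ f g d∣g = Divisible-≈ (ℛ.*-comm g f) (Divisible-⊗ˡ g f d∣g)

    Divisible-⟪⟫⁻¹ : Prime d → ∀ c f → ¬ (d ∣ c) → Divisible (⟪ c ⟫ ⊗ f) → Divisible f
    Divisible-⟪⟫⁻¹ d-prime c f d∤c d∣cf k with euclidsLemma c (f k) d-prime (subst (d ∣_) (⟪⟫-⊗ c f k) (d∣cf k))
    ... | inj₁ d∣c  = ⊥-elim (d∤c d∣c)
    ... | inj₂ d∣fk = d∣fk

  ∏1-γ : ∀ K → (Fin K → ℕ) → R m
  ∏1-γ K c = product (λ k → 1ᶜ ⊕ ⊖ γ (c k))

  1-γ-⊗-coeff : ∀ c f k → ((1ᶜ ⊕ ⊖ γ c) ⊗ f) k ≡ f k + n * f (k ⊟ idx m c)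
  1-γ-⊗-coeff c f k = begin
    ((1ᶜ ⊕ ⊖ γ c) ⊗ f) k          ≡⟨ ⊗-def _ f k ⟩
    ((1ᶜ ⊕ ⊖ γ c) *ᶜ f) k         ≡⟨ *ᶜ-congʳ f (⊕-def 1ᶜ (⊖ γ c)) k ⟩
    ((1ᶜ +ᶜ ⊖ γ c) *ᶜ f) k        ≡⟨ *ᶜ-distribʳ f 1ᶜ (⊖ γ c) k ⟩
    (1ᶜ *ᶜ f) k + (⊖ γ c *ᶜ f) k  ≡⟨ cong₂ _+_ (1ᶜ-*ᶜ f k) (*ᶜ-congʳ f ⊖γ≗mono k) ⟩
    f k + (mono m n c *ᶜ f) k     ≡⟨ cong (f k +_) (mono-*ᶜ n c f k) ⟩
    f k + n * f (k ⊟ idx m c)     ∎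
    where
    open ≡-Reasoning
    ⊖γ≗mono : ∀ i → (⊖ γ c) i ≡ mono m n c i
    ⊖γ≗mono i = trans (⊖-def (γ c) i) (trans (if-*ˡ (toℕ i ≡ᵇ c % m) n 1)
      (cong (λ z → if toℕ i ≡ᵇ c % m then z else 0) (*-identityʳ n)))

  ∏1-γ-support : ∀ d → d ∣ m → ∀ K (c : Fin K → ℕ) → (∀ k → d ∣ c k) →
    ∀ a → ¬ (d ∣ toℕ a) → ∏1-γ K c a ≋ 0
  ∏1-γ-support d d∣m zero c d∣c a d∤a with toℕ a ≡ᵇ 0 in a≡0
  ... | true  = ⊥-elim (d∤a (subst (d ∣_) (sym (≡ᵇ⇒≡ (toℕ a) 0 (subst T (sym a≡0) _))) (d ∣0)))
  ... | false = ≋-refl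
  ∏1-γ-support d d∣m (suc K) c d∣c a d∤a = begin
    ∏1-γ (suc K) c a               ≡⟨ 1-γ-⊗-coeff (c fzero) f a ⟩
    f a + n * f (a ⊟ idx m (c fzero)) ≈⟨ ≋-+ (IH a d∤a) (≋-* (≋-refl {n}) (IH (a ⊟ idx m (c fzero)) d∤a⊟c₀)) ⟩
    0 + n * 0                      ≡⟨ *-zeroʳ n ⟩
    0                              ∎
    where
    open import Relation.Binary.Reasoning.Setoid ≋-setoid
    f : R m
    f = ∏1-γ K (c ∘ fsuc)
    IH : ∀ a → ¬ (d ∣ toℕ a) → f a ≋ 0
    IH = ∏1-γ-support d d∣m K (c ∘ fsuc) (d∣c ∘ fsuc)
    d∤a⊟c₀ : ¬ (d ∣ toℕ (a ⊟ idx m (c fzero)))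
    d∤a⊟c₀ d∣a⊟c₀ = d∤a (≋-∣ d∣m (⊟-spec a (idx m (c fzero)))
      (∣m∣n⇒∣m+n d∣a⊟c₀ (≋-∣ d∣m (≋-sym (idx-≋ (c fzero))) (d∣c fzero))))

  ∏1-γ-constant : ∀ K (c P : Fin K → ℕ) → (∀ k → P k ∣ m) →
    (∀ k k′ → k ≢ k′ → P k ∣ c k′) → (∀ k → ¬ (P k ∣ c k)) → ∏1-γ K c fzero ≋ 1
  ∏1-γ-constant zero    c P P∣m P∣c P∤c = ≋-refl
  ∏1-γ-constant (suc K) c P P∣m P∣c P∤c = begin
    ∏1-γ (suc K) c fzero  ≡⟨ 1-γ-⊗-coeff (c fzero) f fzero ⟩
    f fzero + n * f x     ≈⟨ ≋-+ IH (≋-* (≋-refl {n}) fx≋0) ⟩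
    1 + n * 0             ≡⟨ cong (1 +_) (*-zeroʳ n) ⟩
    1                     ∎
    where
    open import Relation.Binary.Reasoning.Setoid ≋-setoid
    f : R m
    f = ∏1-γ K (c ∘ fsuc)
    x : Fin m
    x = fzero ⊟ idx m (c fzero)
    IH : f fzero ≋ 1
    IH = ∏1-γ-constant K (c ∘ fsuc) (P ∘ fsuc) (P∣m ∘ fsuc)
           (λ k k′ k≢k′ → P∣c (fsuc k) (fsuc k′) (k≢k′ ∘ suc-injective)) (P∤c ∘ fsuc)
    -- x + c 0 ≡ 0 modulo m, so P 0 ∤ x
    P₀∤x : ¬ (P fzero ∣ toℕ x)
    P₀∤x P₀∣x = P∤c fzero (∣m+n∣m⇒∣n
      (≋-∣ (P∣m fzero) (≋-sym (≋-trans (≋-+ (≋-refl {toℕ x}) (≋-sym (idx-≋ (c fzero)))) (⊟-spec fzero (idx m (c fzero)))))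
           (P fzero ∣0)) P₀∣x)
    fx≋0 : f x ≋ 0
    fx≋0 = ∏1-γ-support (P fzero) (P∣m fzero) K (c ∘ fsuc) (λ k → P∣c fzero (fsuc k) (λ ())) x P₀∤x

  *ᶜ+ᶜ*ᶜ≈ : ∀ f g h k → (f *ᶜ g) +ᶜ (h *ᶜ k) ≈ f ⊗ g ⊕ h ⊗ k
  *ᶜ+ᶜ*ᶜ≈ f g h k = ≗⇒≈ (λ x → sym (trans (⊕-def (f ⊗ g) (h ⊗ k) x) (cong₂ _+_ (⊗-def f g x) (⊗-def h k x))))

module Construction (s : ℕ) (p : Fin (suc s) → ℕ) (prime : ∀ i → Prime (p i))
  (distinct : ∀ i j → p i ≡ p j → i ≡ j) (n : ℕ) (m≡Π : suc n ≡ Πfin (suc s) p) where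

  open import Data.Nat using (zero; _+_; _*_; _^_; _≤_; _<_; _≡ᵇ_; nonTrivial⇒n>1)
  import Data.Nat as ℕ
  open import Data.Nat.Properties using (*-zeroʳ; *-identityʳ; +-comm; ≤-trans; ≤-reflexive)
  open import Data.Nat.DivMod using (_%_; m*n%n≡0; [m+kn]%n≡m%n; m<n⇒m%n≡m)
  open import Data.Nat.Divisibility using (_∣_; ∣-refl; ∣m⇒∣m*n; ∣n⇒∣m*n; n∣m*n; ∣m∣n⇒∣m+n; ∣m+n∣m⇒∣n; m%n≡0⇒n∣m; n∣m⇒m%n≡0)
  open import Data.Nat.Tactic.RingSolver using (solve-∀)
  open import Data.Nat.Primality using (euclidsLemma; prime⇒nonTrivial)
  open import Data.Fin using (toℕ; fromℕ<; punchIn) renaming (zero to fzero)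
  open import Data.Fin.Properties using (any?; all?; toℕ-fromℕ<; punchInᵢ≢i; punchIn-injective)
  open import Data.Bool using (Bool; true; false; if_then_else_)
  import Data.Bool.Properties as Bool
  open import Data.Vec using (Vec; lookup; tabulate)
  open import Data.Vec.Properties using (lookup∘tabulate)
  open import Data.List using (List; map; length)
  open import Data.List.Properties using (length-map)
  open import Data.List.Membership.Propositional.Properties using (∈-map⁺)
  import Data.List.Relation.Unary.All as All
  open import Data.List.Relation.Unary.All.Properties using () renaming (map⁺ to All-map⁺)
  open import Data.Product using (Σ; _×_; _,_; proj₁; proj₂)
  open import Data.Sum using (_⊎_; inj₁; inj₂)
  open import Data.Empty using (⊥-elim)
  open import Relation.Nullary using (¬_; Dec; yes; no)
  open import Relation.Nullary.Decidable using (_×-dec_)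
  open import Relation.Binary.PropositionalEquality
  open import Function using (_∘_)
  open GroupRing n
  open RingElements n
  open import Algebra.Properties.Group ℛ.+-group using (ε⁻¹≈ε)
  open PrimeProducts
  open SquarefreeModulus (suc s) p prime distinct (suc n) m≡Π
  open Cofactors s p prime distinct
  open CommutativeRingFacts ℛ
  open BooleanVectors
  open FinCases
  open Congruence m

  q : ℕ
  q = 2 ^ s

  bit : Bool → ℕ
  bit b = if b then 1 else 0

  -- Residue patterns.  A subset T of the primes other than p j determines the
  -- exponents a with a ≡ 0 (mod p j) and a ≡ [k ∈ T] (mod p (punchIn j k)).
  HasPattern : Fin (suc s) → Vec Bool s → ℕ → Set
  HasPattern j T a = (a % p j ≡ 0) × (∀ k → a % p (punchIn j k) ≡ bit (lookup T k))

  hasPattern? : ∀ j T a → Dec (HasPattern j T a)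
  hasPattern? j T a = (a % p j ℕ.≟ 0) ×-dec all? (λ k → a % p (punchIn j k) ℕ.≟ bit (lookup T k))

  -- by the Chinese remainder theorem a pattern determines its exponent modulo m
  pattern-unique : ∀ {j T} a b → HasPattern j T a → HasPattern j T b → a % m ≡ b % m
  pattern-unique {j} {T} a b (a₀ , aₖ) (b₀ , bₖ) =
    crt a b (indexCases (λ t → a % p t ≡ b % p t) j (trans a₀ (sym b₀)) (λ k → trans (aₖ k) (sym (bₖ k))))

  -- The j-th polynomial P_j has a root γ^a for each nonzero pattern (j, T).
  Witness : Fin (suc s) → Vec Bool s → Set
  Witness j T = Σ (Fin m) (λ a → HasPattern j T (toℕ a))

  rootOf : ∀ {j T} → Dec (Witness j T) → R m
  rootOf (yes (a , _)) = γ (toℕ a)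
  rootOf (no _)        = ℛ.0#

  root : Fin (suc s) → Vec Bool s → R m
  root j T = rootOf {j} {T} (any? (λ a → hasPattern? j T (toℕ a)))

  roots : Fin (suc s) → List (R m)
  roots j = map (root j) (nonzeroVectors s)

  a : Fin (suc s) → Fin q → R m
  a j i = coeff (rootPoly (roots j)) (toℕ i)

  P-coefficients : ∀ j x → ∑[ i < q ] (a j i ⊗ x ^ᴿ toℕ i) ≈ ∏roots (roots j) x
  P-coefficients j x = ℛ.trans (sum-coeff q (rootPoly (roots j)) x deg<q) (eval-rootPoly (roots j) x)
    where
    deg<q : length (rootPoly (roots j)) ≤ q
    deg<q = ≤-trans (length-rootPoly (roots j)) (≤-reflexive
      (trans (cong suc (length-map (root j) (nonzeroVectors s))) (length-nonzeroVectors s)))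

  α β : Fin q → R m
  α i = ∑[ j < suc s ] (⟪ M j ⟫ ⊗ a j i)
  β i = ∑[ j < suc s ] (⟪ M j ⟫ ⊗ ⊖ a j i)

  column : ℕ → R m
  column ℓ = ∑[ j < suc s ] (⟪ M j ⟫ ⊗ ((1ᶜ ⊕ ⊖ ⟪ ℓ ⟫) ⊗ ∏roots (roots j) (γ ℓ)))

  -- regroup by j (column-identity) and recognise P_j(γ^ℓ) from its coefficients
  column-formula : ∀ ℓ → colEntry m q α β ℓ ≈ column ℓ
  column-formula ℓ = begin
    colEntry m q α β ℓ
      ≈⟨ sumR≈sum q _ ⟩
    ∑[ i < q ] ((α i *ᶜ G i) +ᶜ (β i *ᶜ mono m ℓ (toℕ i * ℓ)))
      ≈⟨ sum-cong-≋ {q} entry ⟩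
    ∑[ i < q ] (α i ⊗ G i ⊕ β i ⊗ (⟪ ℓ ⟫ ⊗ G i))
      ≈⟨ column-identity (λ j → ⟪ M j ⟫) a G ⟪ ℓ ⟫ ⟩
    ∑[ j < suc s ] (⟪ M j ⟫ ⊗ ((1ᶜ ⊕ ⊖ ⟪ ℓ ⟫) ⊗ ∑[ i < q ] (a j i ⊗ G i)))
      ≈⟨ sum-cong-≋ {suc s} (λ j → ℛ.*-congˡ {⟪ M j ⟫} (ℛ.*-congˡ {1ᶜ ⊕ ⊖ ⟪ ℓ ⟫} (P-at-γℓ j))) ⟩
    column ℓ ∎
    where
    open import Relation.Binary.Reasoning.Setoid ℛ.setoid
    G : Fin q → R m
    G i = γ (toℕ i * ℓ)
    entry : ∀ i → (α i *ᶜ G i) +ᶜ (β i *ᶜ mono m ℓ (toℕ i * ℓ)) ≈ α i ⊗ G i ⊕ β i ⊗ (⟪ ℓ ⟫ ⊗ G i)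
    entry i = ℛ.trans (*ᶜ+ᶜ*ᶜ≈ (α i) (G i) (β i) _) (ℛ.+-congˡ (ℛ.*-congˡ (mono≈⟪⟫⊗γ ℓ (toℕ i * ℓ))))
    P-at-γℓ : ∀ j → ∑[ i < q ] (a j i ⊗ G i) ≈ ∏roots (roots j) (γ ℓ)
    P-at-γℓ j = ℛ.trans (sum-cong-≋ {q} (λ i → ℛ.*-congˡ (ℛ.sym (γ-^ ℓ (toℕ i))))) (P-coefficients j (γ ℓ))

  ModIn01⇒residue : ∀ i ℓ → ModIn01 (p i) ℓ → (ℓ % p i ≡ 0) ⊎ (ℓ % p i ≡ 1)
  ModIn01⇒residue i ℓ (k , inj₁ ℓ≡kp)   = inj₁ (trans (cong (_% p i) ℓ≡kp) (m*n%n≡0 k (p i)))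
  ModIn01⇒residue i ℓ (k , inj₂ ℓ≡kp+1) = inj₂ (begin
    ℓ % p i           ≡⟨ cong (_% p i) (trans ℓ≡kp+1 (+-comm (k * p i) 1)) ⟩
    (1 + k * p i) % p i ≡⟨ [m+kn]%n≡m%n 1 k (p i) ⟩
    1 % p i           ≡⟨ m<n⇒m%n≡m (nonTrivial⇒n>1 (p i) {{prime⇒nonTrivial (prime i)}}) ⟩
    1                 ∎)
    where open ≡-Reasoning

  residue≡bit : ∀ {x} → (x ≡ 0) ⊎ (x ≡ 1) → x ≡ bit (x ≡ᵇ 1)
  residue≡bit (inj₁ refl) = refl
  residue≡bit (inj₂ refl) = refl

  all-residues-0 : ∀ {ℓ} → ℓ < m → (∀ i → ℓ % p i ≡ 0) → ℓ ≡ 0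
  all-residues-0 {ℓ} ℓ<m ℓ≡0 = trans (sym (m<n⇒m%n≡m ℓ<m)) (crt ℓ 0 (λ i → trans (ℓ≡0 i) (sym (Congruence.0%d≡0 (p i)))))

  patternOf : ℕ → Fin (suc s) → Vec Bool s
  patternOf ℓ j = tabulate (λ k → ℓ % p (punchIn j k) ≡ᵇ 1)

  module RootFromS {ℓ} (ℓ∈S : InS (suc s) p m ℓ) {j} (ℓ≡0 : ℓ % p j ≡ 0) where

    T : Vec Bool s
    T = patternOf ℓ j

    ℓ-pattern : HasPattern j T ℓ
    ℓ-pattern = ℓ≡0 , λ k → trans (residue≡bit (ModIn01⇒residue _ ℓ (proj₂ (proj₂ ℓ∈S) (punchIn j k))))
                                  (cong bit (sym (lookup∘tabulate _ k)))

    -- the pattern is nonzero since ℓ ≠ 0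
    T-nonzero : Nonzero T
    T-nonzero with any? (λ k → lookup T k Bool.≟ true)
    ... | yes nz   = nz
    ... | no none = ⊥-elim (proj₁ (proj₂ ℓ∈S) (all-residues-0 (proj₁ ℓ∈S)
                      (indexCases (λ t → ℓ % p t ≡ 0) j ℓ≡0 (λ k → trans (proj₂ ℓ-pattern k) (bit-false k)))))
      where
      bit-false : ∀ k → bit (lookup T k) ≡ 0
      bit-false k with lookup T k in Tₖ
      ... | true  = ⊥-elim (none (k , Tₖ))
      ... | false = refl

    γℓ≈root : γ ℓ ≈ root j T
    γℓ≈root = γℓ≈rootOf (any? (λ a → hasPattern? j T (toℕ a)))
      where
      γℓ≈rootOf : (w : Dec (Witness j T)) → γ ℓ ≈ rootOf {j} {T} w
      γℓ≈rootOf (yes (a , a-pattern)) = γ-≋ (mk≋ {ℓ} {toℕ a} (pattern-unique {j} {T} ℓ (toℕ a) ℓ-pattern a-pattern))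
      γℓ≈rootOf (no none) =
        ⊥-elim (none (fromℕ< (proj₁ ℓ∈S) , subst (HasPattern j T) (sym (toℕ-fromℕ< (proj₁ ℓ∈S))) ℓ-pattern))

    P-vanishes : ∏roots (roots j) (γ ℓ) ≈ ℛ.0#
    P-vanishes = ∏roots-root (roots j) (γ ℓ) (∈-map⁺ (root j) (∈-nonzeroVectors T T-nonzero)) γℓ≈root

  Mⱼ[1-ℓ]≋0 : ∀ j k ℓ → ℓ ≡ k * p j + 1 → M j * (1 + n * ℓ) ≋ 0
  Mⱼ[1-ℓ]≋0 j k ℓ refl = ∣⇒≋0 (subst (m ∣_) (sym (expand (M j) n k (p j)))
    (∣m∣n⇒∣m+n (n∣m*n (M j)) (∣n⇒∣m*n (n * k) (subst (m ∣_) (sym p*M≡m) ∣-refl))))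
    where
    p*M≡m : p j * M j ≡ m
    p*M≡m = sym (trans m≡Π (Π≡p*M j))
    expand : ∀ M n k P → M * (1 + n * (k * P + 1)) ≡ M * (1 + n) + n * k * (P * M)
    expand = solve-∀

  column-term-vanishes : ∀ ℓ → InS (suc s) p m ℓ → ∀ j →
    ⟪ M j ⟫ ⊗ ((1ᶜ ⊕ ⊖ ⟪ ℓ ⟫) ⊗ ∏roots (roots j) (γ ℓ)) ≈ ℛ.0#
  column-term-vanishes ℓ ℓ∈S j with proj₂ (proj₂ ℓ∈S) j
  ... | k , inj₁ ℓ≡kp = begin
    ⟪ M j ⟫ ⊗ ((1ᶜ ⊕ ⊖ ⟪ ℓ ⟫) ⊗ ∏roots (roots j) (γ ℓ)) ≈⟨ ℛ.*-congˡ (ℛ.*-congˡ (RootFromS.P-vanishes ℓ∈S ℓ≡0)) ⟩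
    ⟪ M j ⟫ ⊗ ((1ᶜ ⊕ ⊖ ⟪ ℓ ⟫) ⊗ ℛ.0#)                     ≈⟨ ℛ.trans (ℛ.*-congˡ (ℛ.zeroʳ _)) (ℛ.zeroʳ _) ⟩
    ℛ.0#                                                 ∎
    where
    open import Relation.Binary.Reasoning.Setoid ℛ.setoid
    ℓ≡0 : ℓ % p j ≡ 0
    ℓ≡0 = trans (cong (_% p j) ℓ≡kp) (m*n%n≡0 k (p j))
  ... | k , inj₂ ℓ≡kp+1 = begin
    ⟪ M j ⟫ ⊗ ((1ᶜ ⊕ ⊖ ⟪ ℓ ⟫) ⊗ X)      ≈⟨ ℛ.sym (ℛ.*-assoc _ _ _) ⟩
    ⟪ M j ⟫ ⊗ (1ᶜ ⊕ ⊖ ⟪ ℓ ⟫) ⊗ X        ≈⟨ ℛ.*-congʳ (ℛ.trans (ℛ.*-congˡ (1-⟪⟫ ℓ)) (⟪⟫-* (M j) (1 + n * ℓ))) ⟩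
    ⟪ M j * (1 + n * ℓ) ⟫ ⊗ X          ≈⟨ ℛ.*-congʳ (⟪⟫≈0 (Mⱼ[1-ℓ]≋0 j k ℓ ℓ≡kp+1)) ⟩
    ℛ.0# ⊗ X                           ≈⟨ ℛ.zeroˡ X ⟩
    ℛ.0#                               ∎
    where
    open import Relation.Binary.Reasoning.Setoid ℛ.setoid
    X : R m
    X = ∏roots (roots j) (γ ℓ)

  colEntry-vanishes : ∀ ℓ → InS (suc s) p m ℓ → colEntry m q α β ℓ ≈ ℛ.0#
  colEntry-vanishes ℓ ℓ∈S = ℛ.trans (column-formula ℓ) (sum-zero _ (column-term-vanishes ℓ ℓ∈S))

  P₁ : Fin (suc s) → R m
  P₁ j = ∏roots (roots j) ℛ.1#

  column-0 : column 0 ≈ ∑[ j < suc s ] (⟪ M j ⟫ ⊗ P₁ j)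
  column-0 = sum-cong-≋ {suc s} (λ j → ℛ.*-congˡ {⟪ M j ⟫} (ℛ.trans (ℛ.*-congʳ 1-0≈1) (ℛ.*-identityˡ (P₁ j))))
    where
    1-0≈1 : 1ᶜ ⊕ ⊖ ⟪ 0 ⟫ ≈ ℛ.1#
    1-0≈1 = ℛ.trans (1-⟪⟫ 0) (⟪⟫-cong (≡⇒≋ (cong (1 +_) (*-zeroʳ n))))

  Mᵢ*Mⱼ≋0 : ∀ {i j} → j ≢ i → M i * M j ≋ 0
  Mᵢ*Mⱼ≋0 {i} {j} j≢i = ∣⇒≋0 (all-pᵢ∣⇒m∣ _ (indexCases (λ t → p t ∣ M i * M j) i
    (∣n⇒∣m*n (M i) (pₖ∣Mᵢ (j≢i ∘ sym))) (λ k → ∣m⇒∣m*n (M j) (pₖ∣Mᵢ (punchInᵢ≢i i k)))))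

  Mᵢ⊗column-0 : ∀ i → ⟪ M i ⟫ ⊗ column 0 ≈ ⟪ M i ⟫ ⊗ (⟪ M i ⟫ ⊗ P₁ i)
  Mᵢ⊗column-0 i = begin
    ⟪ M i ⟫ ⊗ column 0                             ≈⟨ ℛ.*-congˡ column-0 ⟩
    ⟪ M i ⟫ ⊗ ∑[ j < suc s ] (⟪ M j ⟫ ⊗ P₁ j)        ≈⟨ *-distribˡ-sum ⟪ M i ⟫ (λ j → ⟪ M j ⟫ ⊗ P₁ j) ⟩
    ∑[ j < suc s ] (⟪ M i ⟫ ⊗ (⟪ M j ⟫ ⊗ P₁ j))      ≈⟨ sum-single (λ j → ⟪ M i ⟫ ⊗ (⟪ M j ⟫ ⊗ P₁ j)) i others ⟩
    ⟪ M i ⟫ ⊗ (⟪ M i ⟫ ⊗ P₁ i)                     ∎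
    where
    open import Relation.Binary.Reasoning.Setoid ℛ.setoid
    others : ∀ j → j ≢ i → ⟪ M i ⟫ ⊗ (⟪ M j ⟫ ⊗ P₁ j) ≈ ℛ.0#
    others j j≢i = ℛ.trans (ℛ.sym (ℛ.*-assoc _ _ _))
      (ℛ.trans (ℛ.*-congʳ (ℛ.trans (⟪⟫-* (M i) (M j)) (⟪⟫≈0 (Mᵢ*Mⱼ≋0 j≢i)))) (ℛ.zeroˡ _))

  module AtPrime (i : Fin (suc s)) where

    open Multiples (p i) (pᵢ∣m i)

    v : R m
    v = ∏1-γ s (λ k → M (punchIn i k))

    u : R m
    u = ⊖ (M i ×ᴿ ℛ.1#)

    v-constant : v fzero ≋ 1
    v-constant = ∏1-γ-constant s (λ k → M (punchIn i k)) (λ k → p (punchIn i k)) (λ k → pᵢ∣m (punchIn i k))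
      (λ k k′ k≢k′ → pₖ∣Mᵢ (k≢k′ ∘ punchIn-injective i k k′)) (λ k → pᵢ∤Mᵢ (punchIn i k))

    RootCondition : R m → Set
    RootCondition ρ = Σ (R m) (λ w → (1ᶜ ⊕ ⊖ ρ) ⊗ w ⊗ v ≈ u ⊗ v)

    zero-root : RootCondition ℛ.0#
    zero-root = u , ℛ.*-congʳ (ℛ.trans (ℛ.*-congʳ (ℛ.trans (ℛ.+-congˡ ε⁻¹≈ε) (ℛ.+-identityʳ _))) (ℛ.*-identityˡ u))

    -- x = γ^A with pattern (i, T), T ∋ k₀, has order dividing M i, x^(M k′) = γ^(M k′)
    -- for k′ = punchIn i k₀, so its geometric sum is killed by v
    pattern-root : ∀ T → Nonzero T → ∀ A → HasPattern i T A → RootCondition (γ A)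
    pattern-root T (k₀ , Tₖ₀) A (A₀ , Aₖ) = wsum x (M i) , one-minus-root-divides x (M i) v xᴹⁱ≈1 Gv≈0
      where
      x : R m
      x = γ A
      k′ : Fin (suc s)
      k′ = punchIn i k₀
      Mᵢ*A≋0 : M i * A ≋ 0
      Mᵢ*A≋0 = ∣⇒≋0 (all-pᵢ∣⇒m∣ _ (indexCases (λ t → p t ∣ M i * A) i
        (∣n⇒∣m*n (M i) (m%n≡0⇒n∣m A (p i) A₀)) (λ k → ∣m⇒∣m*n A (pₖ∣Mᵢ (punchInᵢ≢i i k)))))
      xᴹⁱ≈1 : x ^ᴿ M i ≈ ℛ.1#
      xᴹⁱ≈1 = ℛ.trans (γ-^ A (M i)) (γ-≋ Mᵢ*A≋0)
      A≡1 : A % p k′ ≡ 1 % p k′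
      A≡1 = trans (Aₖ k₀) (trans (cong bit Tₖ₀) (sym (m<n⇒m%n≡m (nonTrivial⇒n>1 (p k′) {{prime⇒nonTrivial (prime k′)}}))))
      Mₖ′*A≋Mₖ′ : M k′ * A ≋ M k′
      Mₖ′*A≋Mₖ′ = mk≋ (crt _ _ (indexCases (λ t → (M k′ * A) % p t ≡ M k′ % p t) k′ at-k′ elsewhere))
        where
        at-k′ : (M k′ * A) % p k′ ≡ M k′ % p k′
        at-k′ = Pₖ′.un≋ (Pₖ′.≋-trans (Pₖ′.≋-* (Pₖ′.≋-refl {M k′}) (Pₖ′.mk≋ {A} {1} A≡1)) (Pₖ′.≡⇒≋ (*-identityʳ (M k′))))
          where module Pₖ′ = Congruence (p k′)
        elsewhere : ∀ t → (M k′ * A) % p (punchIn k′ t) ≡ M k′ % p (punchIn k′ t)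
        elsewhere t = trans (n∣m⇒m%n≡0 _ _ (∣m⇒∣m*n A pₜ∣Mₖ′)) (sym (n∣m⇒m%n≡0 _ _ pₜ∣Mₖ′))
          where
          pₜ∣Mₖ′ : p (punchIn k′ t) ∣ M k′
          pₜ∣Mₖ′ = pₖ∣Mᵢ (punchInᵢ≢i k′ t)
      Gv≈0 : geo x (M i) ⊗ v ≈ ℛ.0#
      Gv≈0 = product-annihilated (λ k → 1ᶜ ⊕ ⊖ γ (M (punchIn i k))) (geo x (M i)) k₀
        (geo-annihilates x (M i) (M k′) xᴹⁱ≈1 (ℛ.trans (γ-^ A (M k′)) (γ-≋ Mₖ′*A≋Mₖ′)))

    root-condition : ∀ T → Nonzero T → RootCondition (root i T)
    root-condition T nz = from-search (any? (λ a → hasPattern? i T (toℕ a)))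
      where
      from-search : (w : Dec (Witness i T)) → RootCondition (rootOf {i} {T} w)
      from-search (yes (A , A-pattern)) = pattern-root T nz (toℕ A) A-pattern
      from-search (no _)                = zero-root

    L : ℕ
    L = length (roots i)

    P₁-relation : Σ (R m) (λ W → P₁ i ⊗ W ⊗ v ≈ ⟪ (n * M i) ^ L ⟫ ⊗ v)
    P₁-relation with ∏roots-divides v u (roots i) (All-map⁺ (All.map (λ {T} → root-condition T) (nonzeroVectors-nonzero s)))
    ... | W , eq = W , ℛ.trans eq (ℛ.*-congʳ (ℛ.trans (^ᴿ-congˡ L u≈) (^ᴿ-⟪⟫ (n * M i) L)))
      where
      u≈ : u ≈ ⟪ n * M i ⟫
      u≈ = ℛ.trans (⊖≈⟪n⟫⊗ _) (ℛ.trans (ℛ.*-congˡ (×ᴿ1≈⟪⟫ (M i))) (⟪⟫-* n (M i)))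

    -- p i divides no power of n·M i, as n ≡ −1 and M i are prime to p i
    pᵢ∤[nMᵢ]^ : ∀ k → ¬ (p i ∣ (n * M i) ^ k)
    pᵢ∤[nMᵢ]^ zero    = prime∤1 (prime i)
    pᵢ∤[nMᵢ]^ (suc k) pᵢ∣ with euclidsLemma (n * M i) _ (prime i) pᵢ∣
    ... | inj₂ pᵢ∣′ = pᵢ∤[nMᵢ]^ k pᵢ∣′
    ... | inj₁ pᵢ∣nMᵢ with euclidsLemma n (M i) (prime i) pᵢ∣nMᵢ
    ...   | inj₁ pᵢ∣n  = prime∤1 (prime i) (∣m+n∣m⇒∣n (subst (p i ∣_) (+-comm 1 n) (pᵢ∣m i)) pᵢ∣n)
    ...   | inj₂ pᵢ∣Mᵢ = pᵢ∤Mᵢ i pᵢ∣Mᵢ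

    -- if p i divided every coefficient of μ, it would divide v(0) ≡ 1
    μ-not-divisible : ¬ Divisible (colEntry m q α β 0)
    μ-not-divisible p∣μ with P₁-relation
    ... | W , eq = prime∤1 (prime i) (≋-∣ (pᵢ∣m i) v-constant (p∣v fzero))
      where
      p∣MMP₁ : Divisible (⟪ M i ⟫ ⊗ (⟪ M i ⟫ ⊗ P₁ i))
      p∣MMP₁ = Divisible-≈ (Mᵢ⊗column-0 i) (Divisible-⊗ʳ ⟪ M i ⟫ (column 0) (Divisible-≈ (column-formula 0) p∣μ))
      p∣P₁ : Divisible (P₁ i)
      p∣P₁ = Divisible-⟪⟫⁻¹ (prime i) (M i) (P₁ i) (pᵢ∤Mᵢ i)
               (Divisible-⟪⟫⁻¹ (prime i) (M i) (⟪ M i ⟫ ⊗ P₁ i) (pᵢ∤Mᵢ i) p∣MMP₁)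
      p∣v : Divisible v
      p∣v = Divisible-⟪⟫⁻¹ (prime i) ((n * M i) ^ L) v (pᵢ∤[nMᵢ]^ L)
              (Divisible-≈ eq (Divisible-⊗ˡ (P₁ i ⊗ W) v (Divisible-⊗ˡ (P₁ i) W p∣P₁)))

-- The theorem.  These imports come last because ℕ's _^_ and the product _×_
-- would clash with the ring notation of the modules above.

open import Data.Nat using (zero; _≤_; _∸_; _^_; ≢-nonZero⁻¹)
open import Data.Nat.Divisibility using (_∣_; _∣?_)
open import Data.Fin.Properties using (¬∀⟶∃¬)
open import Data.Product using (Σ; _×_; _,_)
open import Data.Empty using (⊥-elim)
open import Relation.Nullary using (¬_)
open import Relation.Binary.PropositionalEquality using (refl)

lemma5p1 : (r : ℕ) → 2 ≤ r → (p : Fin r → ℕ) → (∀ i → Prime (p i)) →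
    (∀ i j → p i ≡ p j → i ≡ j) →
    (m : ℕ) .{{_ : NonZero m}} → m ≡ Πfin r p →
    Σ (Fin (2 ^ (r ∸ 1)) → R m) (λ α → Σ (Fin (2 ^ (r ∸ 1)) → R m) (λ β → Σ (R m) (λ μ →
      (_≈R_ m (colEntry m (2 ^ (r ∸ 1)) α β 0) μ)
      × (∀ ℓ → InS r p m ℓ → _≈R_ m (colEntry m (2 ^ (r ∸ 1)) α β ℓ) (0R m))
      × (∀ i → Σ (Fin m) (λ k → ¬ (p i ∣ μ k))))))
lemma5p1 zero    ()
lemma5p1 (suc s) _ p prime distinct zero    _   = ⊥-elim (≢-nonZero⁻¹ zero refl)
lemma5p1 (suc s) _ p prime distinct (suc n) m≡Π =
  α , β , μ , (λ k → refl) , (λ ℓ ℓ∈S → unwrap (colEntry-vanishes ℓ ℓ∈S)) , μ≢0-mod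
  where
  open Construction s p prime distinct n m≡Π
  open GroupRing n using (unwrap)
  μ : R (suc n)
  μ = colEntry (suc n) q α β 0
  μ≢0-mod : ∀ i → Σ (Fin (suc n)) (λ k → ¬ (p i ∣ μ k))
  μ≢0-mod i = ¬∀⟶∃¬ (suc n) (λ k → p i ∣ μ k) (λ k → p i ∣? μ k) (AtPrime.μ-not-divisible i)
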